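{- For all graphs $G$, $H$ and every context $C[\cdot]_R$ (a graph $C$ with $R\subseteq V_C$): if $\vdash_{\mathsf{GS}} G\multimap H$ then $\vdash_{\mathsf{GS}} C[G]_R\multimap C[H]_R$.
   Context: Atoms: a countable set $\mathcal V$ of variables and a disjoint copy $\overline{\mathcal V}$; atoms are elements of $\mathcal V\cup\overline{\mathcal V}$, with $\overline{\overline a}=a$. A graph is a finite simple undirected graph with vertices labelled by atoms, identified up to label-preserving isomorphism; $\emptyset$ is the empty graph; $a$ also denotes a one-vertex graph. $G\sqcup H$ is disjoint union; $G\otimes H$ is disjoint union plus all edges between $V_G$ and $V_H$. $\overline G$: same vertices, complementary edges, dual labels. $G\multimap H:=\overline G\sqcup H$. $C[M]_R$ is $C\sqcup M$ plus all edges between $V_M$ and $R$. A module of $G$ is an induced subgraph $M$ with every outside vertex adjacent to all or none of $M$; $P$ is prime if $|V_P|\ge2$ and its only modules are $\emptyset$, singletons and $P$. For $G$ with vertices $v_1,\dots,v_n$, $G\langle H_1,\dots,H_n\rangle$ replaces $v_i$ by $H_i$, keeps internal edges, joins $H_i$ to $H_j$ ($i\ne j$) iff $v_iv_j\in E_G$; $\overline G\langle\cdots\rangle$ uses the same vertex order. Rules of $\mathsf{GS}$: $\mathsf{ai}{\downarrow}$: $\emptyset\longrightarrow\overline a\sqcup a$; $\mathsf{ss}{\downarrow}$: $B[A]_S\longrightarrow B\sqcup A$, $S\subseteq V_B$, $S\ne\emptyset$, $A\ne\emptyset$; $\mathsf{p}{\downarrow}$: $(M_1\sqcup N_1)\otimes\cdots\otimes(M_n\sqcup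 N_n)\longrightarrow\overline P\langle M_1,\dots,M_n\rangle\sqcup P\langle N_1,\dots,N_n\rangle$, $P$ prime, $n=|V_P|\ge4$, all $M_i\ne\emptyset$. $\vdash_{\mathsf{GS}}X$ means there is a finite sequence of graphs from $\emptyset$ to $X$ each step of which is a label-preserving isomorphism or replaces $D[X']_T$ by $D[Y']_T$ for a context $D[\cdot]_T$ and a rule instance $X'\longrightarrow Y'$. -}

module Defs where

open import Data.Nat using (ℕ; zero; suc; _+_; _≤_; _<_)
open import Data.Bool using (Bool; true; false; not; if_then_else_)
open import Data.Fin using (Fin; zero; suc; splitAt; _≟_)
open import Data.Sum using (_⊎_; inj₁; inj₂)
open import Data.Product using (Σ; _×_; _,_; ∃; ∃-syntax; proj₁; proj₂)
open import Data.Empty using (⊥-elim)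
open import Relation.Nullary using (yes; no; ¬_)
open import Relation.Binary.PropositionalEquality using (_≡_; refl; sym; trans)
open import Function.Bundles using (_↔_; Inverse)
open import Relation.Binary.Construct.Closure.ReflexiveTransitive using (Star)

-- Atoms: a variable (a natural number) together with a polarity.
-- (true , v) is the variable v, (false , v) is its dual copy v̄.

Atom : Set
Atom = Bool × ℕ

dual : Atom → Atom
dual (b , v) = (not b , v)

-- Graphs are identified up to label-preserving isomorphism (_≅_ below).

record Graph : Set where
  field
    size  : ℕ
    lab   : Fin size → Atom
    adj   : Fin size → Fin size → Bool
    adj-sym   : ∀ x y → adj x y ≡ adj y x
    adj-irrefl : ∀ x → adj x x ≡ false
open Graph public

record _≅_ (G H : Graph) : Set where
  field
    iso      : Fin (size G) ↔ Fin (size H)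
    iso-lab  : ∀ x → lab H (Inverse.to iso x) ≡ lab G x
    iso-adj  : ∀ x y → adj H (Inverse.to iso x) (Inverse.to iso y) ≡ adj G x y

emptyG : Graph
emptyG = record { size = 0 ; lab = λ () ; adj = λ () ; adj-sym = λ () ; adj-irrefl = λ () }

atomG : Atom → Graph
atomG a = record { size = 1 ; lab = λ _ → a ; adj = λ _ _ → false
                 ; adj-sym = λ _ _ → refl ; adj-irrefl = λ _ → refl }

module _ (G H : Graph) (cross : Fin (size G) → Fin (size H) → Bool) where
  private
    V⊎ = Fin (size G) ⊎ Fin (size H)

    adj⊎ : V⊎ → V⊎ → Bool
    adj⊎ (inj₁ x) (inj₁ y) = adj G x y
    adj⊎ (inj₂ x) (inj₂ y) = adj H x y
    adj⊎ (inj₁ x) (inj₂ y) = cross x y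
    adj⊎ (inj₂ y) (inj₁ x) = cross x y

    lab⊎ : V⊎ → Atom
    lab⊎ (inj₁ x) = lab G x
    lab⊎ (inj₂ y) = lab H y

    sym⊎ : ∀ u v → adj⊎ u v ≡ adj⊎ v u
    sym⊎ (inj₁ x) (inj₁ y) = adj-sym G x y
    sym⊎ (inj₂ x) (inj₂ y) = adj-sym H x y
    sym⊎ (inj₁ x) (inj₂ y) = refl
    sym⊎ (inj₂ y) (inj₁ x) = refl

    irr⊎ : ∀ u → adj⊎ u u ≡ false
    irr⊎ (inj₁ x) = adj-irrefl G x
    irr⊎ (inj₂ x) = adj-irrefl H x

  glue : Graph
  glue = record
    { size = size G + size H
    ; lab  = λ x → lab⊎ (splitAt (size G) x)
    ; adj  = λ x y → adj⊎ (splitAt (size G) x) (splitAt (size G) y)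
    ; adj-sym = λ x y → sym⊎ (splitAt (size G) x) (splitAt (size G) y)
    ; adj-irrefl = λ x → irr⊎ (splitAt (size G) x)
    }

_⊔_ : Graph → Graph → Graph
G ⊔ H = glue G H (λ _ _ → false)

_⊗_ : Graph → Graph → Graph
G ⊗ H = glue G H (λ _ _ → true)

_[_]⟨_⟩ : (C : Graph) → Graph → (Fin (size C) → Bool) → Graph
C [ M ]⟨ R ⟩ = glue C M (λ c _ → R c)

private
  cadj : (G : Graph) → Fin (size G) → Fin (size G) → Bool
  cadj G x y with x ≟ y
  ... | yes _ = false
  ... | no  _ = not (adj G x y)

  csym : (G : Graph) → ∀ x y → cadj G x y ≡ cadj G y x
  csym G x y with x ≟ y | y ≟ x
  ... | yes _ | yes _ = refl
  ... | yes p | no ¬q = ⊥-elim (¬q (sym p))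
  ... | no ¬p | yes q = ⊥-elim (¬p (sym q))
  ... | no _  | no _  rewrite adj-sym G x y = refl

  cirr : (G : Graph) → ∀ x → cadj G x x ≡ false
  cirr G x with x ≟ x
  ... | yes _ = refl
  ... | no ¬p = ⊥-elim (¬p refl)

dualG : Graph → Graph
dualG G = record
  { size = size G
  ; lab = λ x → dual (lab G x)
  ; adj = cadj G
  ; adj-sym = csym G
  ; adj-irrefl = cirr G
  }

_⊸_ : Graph → Graph → Graph
G ⊸ H = dualG G ⊔ H

bigTensor : (n : ℕ) → (Fin n → Graph) → Graph
bigTensor zero    F = emptyG
bigTensor (suc n) F = F zero ⊗ bigTensor n (λ i → F (suc i))

-- Graph substitution G⟨H_1, ..., H_n⟩ (n = size G).
-- Vertices: Fin (∑ sizes), decoded into pairs (i , vertex of H_i)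
-- in the order H_0 first, then H_1, ... .

∑ : (n : ℕ) → (Fin n → ℕ) → ℕ
∑ zero    s = 0
∑ (suc n) s = s zero + ∑ n (λ i → s (suc i))

decode : (n : ℕ) (s : Fin n → ℕ) → Fin (∑ n s) → Σ (Fin n) (λ i → Fin (s i))
decode (suc n) s x with splitAt (s zero) x
... | inj₁ u = zero , u
... | inj₂ y with decode n (λ i → s (suc i)) y
...   | i , v = suc i , v

module _ (G : Graph) (H : Fin (size G) → Graph) where
  private
    VΣ = Σ (Fin (size G)) (λ i → Fin (size (H i)))

    adjΣ : VΣ → VΣ → Bool
    adjΣ (i , u) (j , v) with i ≟ j
    ... | yes refl = adj (H i) u v
    ... | no  _    = adj G i j

    symΣ : ∀ p q → adjΣ p q ≡ adjΣ q p
    symΣ (i , u) (j , v) with i ≟ j | j ≟ i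
    ... | yes refl | yes refl = adj-sym (H i) u v
    ... | yes refl | no ¬q = ⊥-elim (¬q refl)
    ... | no ¬p | yes refl = ⊥-elim (¬p refl)
    ... | no _  | no _  = adj-sym G i j

    irrΣ : ∀ p → adjΣ p p ≡ false
    irrΣ (i , u) with i ≟ i
    ... | yes refl = adj-irrefl (H i) u
    ... | no ¬p = ⊥-elim (¬p refl)

    dec = decode (size G) (λ i → size (H i))

  subG : Graph
  subG = record
    { size = ∑ (size G) (λ i → size (H i))
    ; lab = λ x → lab (H (proj₁ (dec x))) (proj₂ (dec x))
    ; adj = λ x y → adjΣ (dec x) (dec y)
    ; adj-sym = λ x y → symΣ (dec x) (dec y)
    ; adj-irrefl = λ x → irrΣ (dec x)
    }

_⟨_⟩ : (G : Graph) → (Fin (size G) → Graph) → Graph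
G ⟨ H ⟩ = subG G H

IsModule : (G : Graph) → (Fin (size G) → Bool) → Set
IsModule G S = ∀ v → S v ≡ false →
  (∀ x → S x ≡ true → adj G v x ≡ true) ⊎ (∀ x → S x ≡ true → adj G v x ≡ false)

IsPrime : Graph → Set
IsPrime P = 2 ≤ size P × (∀ S → IsModule P S →
    (∀ x → S x ≡ false)
  ⊎ (∃[ x ] (∀ y → S y ≡ true → y ≡ x) × S x ≡ true)
  ⊎ (∀ x → S x ≡ true))

-- Rules of GS (premise → conclusion)

data Rule : Graph → Graph → Set where
  ai↓ : (a : Atom) → Rule emptyG (atomG (dual a) ⊔ atomG a)
  ss↓ : (B A : Graph) (S : Fin (size B) → Bool) →
        (∃[ x ] S x ≡ true) → 0 < size A →
        Rule (B [ A ]⟨ S ⟩) (B ⊔ A)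
  p↓  : (P : Graph) → IsPrime P → 4 ≤ size P →
        (M N : Fin (size P) → Graph) → (∀ i → 0 < size (M i)) →
        Rule (bigTensor (size P) (λ i → M i ⊔ N i))
             ((dualG P ⟨ M ⟩) ⊔ (P ⟨ N ⟩))

data Step (Z Z′ : Graph) : Set where
  isoStep  : Z ≅ Z′ → Step Z Z′
  ruleStep : (D : Graph) (T : Fin (size D) → Bool) (X Y : Graph) →
             Rule X Y → Z ≅ (D [ X ]⟨ T ⟩) → Z′ ≅ (D [ Y ]⟨ T ⟩) → Step Z Z′

⊢GS : Graph → Set
⊢GS X = Star Step emptyG X

-- If G has a vertex, C[G]_R ⊸ C[H]_R is isomorphic to P̄⟨A⟩ ⊔ P⟨B⟩ for the graph P = C[•]_R with
-- one vertex • for the hole, where A puts ā on each vertex a of C and Ḡ on •, and B puts a on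
-- each vertex a of C and H on •. Each Aᵢ ⊔ Bᵢ is then derivable (by ai↓, resp. ⊢ G ⊸ H), and for
-- every graph Q, derivability of all Aᵢ ⊔ Bᵢ with all Aᵢ nonempty gives that of Q̄⟨A⟩ ⊔ Q⟨B⟩.
-- The latter is proved by induction on the number of vertices of Q: a prime Q with at least four
-- vertices is one p↓ applied to the tensor of the Aᵢ ⊔ Bᵢ; if Q has a nontrivial module M, then
-- Q⟨B⟩ ≅ (Q/M)⟨…, M⟨B|M⟩, …⟩ and dually for Q̄⟨A⟩, so the claim for M supplies the premise
-- of the claim for the smaller quotient Q/M; every three-vertex graph has a nontrivial
-- module, and two-vertex graphs take two switches (ss↓). If G is empty then ⊢ H, and H is plugged
-- into C̄ ⊔ C, which is the claim for Q = C with atoms for A and B.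

module Submission where

open import Defs
open import Data.Bool using (Bool; true; false; not)
import Data.Bool.Properties as Bool
open import Data.Empty using (⊥; ⊥-elim)
open import Data.Fin using (Fin; zero; suc; splitAt; _↑ˡ_; _↑ʳ_)
import Data.Fin as Fin
open import Data.Fin.Properties using (+↔⊎; 1↔⊤; join-splitAt; splitAt-↑ˡ; splitAt-↑ʳ; all?; any?; ¬∀⟶∃¬)
open import Data.Nat using (ℕ; zero; suc; _+_; _≤_; _<_; z≤n; s≤s)
open import Data.Nat.Properties using (+-suc; +-comm; +-monoʳ-≤; m<n+m; m≤m+n; ≤-trans)
open import Data.Product using (Σ; _×_; _,_; ∃-syntax; proj₁; proj₂)
import Data.Product.Properties as Product
open import Data.Sum using (_⊎_; inj₁; inj₂)
import Data.Sum
import Data.Sum.Properties as Sum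
open import Data.Sum.Properties using (swap-↔)
open import Data.Sum.Algebra using (⊎-assoc)
open import Data.Sum.Function.Propositional using (_⊎-↔_)
open import Data.Unit using (⊤; tt)
open import Function.Bundles using (_↔_; Inverse; Injection; mk↔ₛ′)
open import Function.Properties.Inverse using (↔-refl; ↔-sym; ↔-trans; ↔⇒↣)
open import Relation.Binary.Bundles using (Setoid; Preorder)
open import Function.Base using (_∘′_; _on_)
open import Induction.WellFounded using (WfRec; module All)
import Relation.Binary.Construct.On as On
open import Data.Nat.Induction using (<-wellFounded)
open import Relation.Binary.Definitions using (DecidableEquality)
open import Relation.Binary.Structures using (IsEquivalence)
open import Relation.Binary.PropositionalEquality
open import Axiom.UniquenessOfIdentityProofs.WithK using (uip)
open import Relation.Nullary using (yes; no; ¬_; Dec; ¬?; does)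
open import Relation.Nullary.Decidable using (_→-dec_; _⊎-dec_; _×-dec_)
open import Data.Fin.Subset.Properties using (anySubset?)
open import Data.Vec using (lookup; tabulate)
open import Data.Vec.Properties using (lookup∘tabulate)
import Relation.Binary.Reasoning.Setoid
import Relation.Binary.Reasoning.Preorder
open import Relation.Binary.Construct.Closure.ReflexiveTransitive using (Star; ε; _◅_; _◅◅_)

open Inverse using (to; from; strictlyInverseˡ; strictlyInverseʳ)

↔-injective : ∀ {A B : Set} (f : A ↔ B) {x y} → to f x ≡ to f y → x ≡ y
↔-injective f = Injection.injective (↔⇒↣ f)

Fiber : ∀ {A : Set} → (A → Bool) → Bool → Set
Fiber {A} S b = Σ A (λ x → S x ≡ b)

Fiber-≡ : ∀ {A : Set} {S : A → Bool} {b} {p q : Fiber S b} → proj₁ p ≡ proj₁ q → p ≡ q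
Fiber-≡ {p = x , p} {q = .x , q} refl = cong (x ,_) (uip p q)

Fiber-dec : ∀ {A : Set} {S : A → Bool} {b} → DecidableEquality A → DecidableEquality (Fiber S b)
Fiber-dec A-dec (x , p) (y , q) with A-dec x y
... | yes refl = yes (Fiber-≡ refl)
... | no x≢y   = no (λ e → x≢y (cong proj₁ e))

-- Graphs on arbitrary vertex types

-- Here glueing, substitution and restriction act on vertices by ⊎, Σ and reindexing, so
-- isomorphisms between such constructions are defined by pattern matching, not Fin arithmetic.
record SetGraph : Set₁ where
  field
    V           : Set
    V-dec       : DecidableEquality V
    label       : V → Atom
    edge        : V → V → Bool
    edge-sym    : ∀ x y → edge x y ≡ edge y x
    edge-irrefl : ∀ x → edge x x ≡ false
open SetGraph public

infix 4 _≃_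

record _≃_ (G H : SetGraph) : Set where
  field
    bij     : V G ↔ V H
    label-≡ : ∀ x → label H (to bij x) ≡ label G x
    edge-≡  : ∀ x y → edge H (to bij x) (to bij y) ≡ edge G x y
open _≃_ public

≃-refl : ∀ {G} → G ≃ G
≃-refl = record { bij = ↔-refl ; label-≡ = λ _ → refl ; edge-≡ = λ _ _ → refl }

≃-sym : ∀ {G H} → G ≃ H → H ≃ G
≃-sym {G} {H} φ = record
  { bij     = ↔-sym (bij φ)
  ; label-≡ = λ y → trans (sym (label-≡ φ (from (bij φ) y)))
                          (cong (label H) (strictlyInverseˡ (bij φ) y))
  ; edge-≡  = λ x y → trans (sym (edge-≡ φ (from (bij φ) x) (from (bij φ) y)))
                            (cong₂ (edge H) (strictlyInverseˡ (bij φ) x) (strictlyInverseˡ (bij φ) y))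
  }

≃-trans : ∀ {G H K} → G ≃ H → H ≃ K → G ≃ K
≃-trans φ ψ = record
  { bij     = ↔-trans (bij φ) (bij ψ)
  ; label-≡ = λ x → trans (label-≡ ψ _) (label-≡ φ x)
  ; edge-≡  = λ x y → trans (edge-≡ ψ _ _) (edge-≡ φ x y)
  }

≃-setoid : Setoid _ _
≃-setoid = record
  { Carrier = SetGraph ; _≈_ = _≃_
  ; isEquivalence = record { refl = ≃-refl ; sym = ≃-sym ; trans = ≃-trans } }

module ≃-Reasoning = Relation.Binary.Reasoning.Setoid ≃-setoid

module _ (G H : SetGraph) (cross : V G → V H → Bool) where

  glueEdge : V G ⊎ V H → V G ⊎ V H → Bool
  glueEdge (inj₁ x) (inj₁ y) = edge G x y
  glueEdge (inj₂ x) (inj₂ y) = edge H x y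
  glueEdge (inj₁ x) (inj₂ y) = cross x y
  glueEdge (inj₂ y) (inj₁ x) = cross x y

  glueLabel : V G ⊎ V H → Atom
  glueLabel (inj₁ x) = label G x
  glueLabel (inj₂ y) = label H y

  glueEdge-sym : ∀ u v → glueEdge u v ≡ glueEdge v u
  glueEdge-sym (inj₁ x) (inj₁ y) = edge-sym G x y
  glueEdge-sym (inj₂ x) (inj₂ y) = edge-sym H x y
  glueEdge-sym (inj₁ x) (inj₂ y) = refl
  glueEdge-sym (inj₂ y) (inj₁ x) = refl

  glueEdge-irrefl : ∀ u → glueEdge u u ≡ false
  glueEdge-irrefl (inj₁ x) = edge-irrefl G x
  glueEdge-irrefl (inj₂ y) = edge-irrefl H y

  glueˢ : SetGraph
  glueˢ = record
    { V = V G ⊎ V H ; V-dec = Sum.≡-dec (V-dec G) (V-dec H)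
    ; label = glueLabel ; edge = glueEdge
    ; edge-sym = glueEdge-sym ; edge-irrefl = glueEdge-irrefl }

complementEdge : ∀ {A : Set} → Dec A → Bool → Bool
complementEdge (yes _) _ = false
complementEdge (no _)  b = not b

complementEdge-cong : ∀ {A B : Set} (a? : Dec A) (b? : Dec B) → (A → B) → (B → A) →
  ∀ {b b′} → b ≡ b′ → complementEdge a? b ≡ complementEdge b? b′
complementEdge-cong (yes _) (yes _) _   _   _ = refl
complementEdge-cong (yes a) (no ¬b) a→b _   _ = ⊥-elim (¬b (a→b a))
complementEdge-cong (no ¬a) (yes b) _   b→a _ = ⊥-elim (¬a (b→a b))
complementEdge-cong (no _)  (no _)  _   _   e = cong not e

module _ (G : SetGraph) where

  dualEdge : V G → V G → Bool
  dualEdge x y = complementEdge (V-dec G x y) (edge G x y)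

  dualˢ : SetGraph
  dualˢ = record
    { V = V G ; V-dec = V-dec G
    ; label = λ x → dual (label G x) ; edge = dualEdge
    ; edge-sym = λ x y → complementEdge-cong (V-dec G x y) (V-dec G y x) sym sym (edge-sym G x y)
    ; edge-irrefl = irrefl }
    where
    irrefl : ∀ x → dualEdge x x ≡ false
    irrefl x with V-dec G x x
    ... | yes _ = refl
    ... | no x≢x = ⊥-elim (x≢x refl)

module _ (G : SetGraph) (H : V G → SetGraph) where

  subEdge′ : ∀ i j → Dec (i ≡ j) → V (H i) → V (H j) → Bool
  subEdge′ i .i (yes refl) u v = edge (H i) u v
  subEdge′ i j  (no _)     _ _ = edge G i j

  subEdge : Σ (V G) (λ i → V (H i)) → Σ (V G) (λ i → V (H i)) → Bool
  subEdge (i , u) (j , v) = subEdge′ i j (V-dec G i j) u v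

  subEdge′-≡ : ∀ i (i≟i : Dec (i ≡ i)) u v → subEdge′ i i i≟i u v ≡ edge (H i) u v
  subEdge′-≡ i (yes refl) u v = refl
  subEdge′-≡ i (no i≢i)  u v = ⊥-elim (i≢i refl)

  subEdge′-≢ : ∀ i j → i ≢ j → (i≟j : Dec (i ≡ j)) → ∀ u v → subEdge′ i j i≟j u v ≡ edge G i j
  subEdge′-≢ i j i≢j (yes i≡j) u v = ⊥-elim (i≢j i≡j)
  subEdge′-≢ i j i≢j (no _)    u v = refl

  subEdge-sym : ∀ p q → subEdge p q ≡ subEdge q p
  subEdge-sym (i , u) (j , v) with V-dec G i j
  ... | yes refl = trans (edge-sym (H i) u v) (sym (subEdge′-≡ i (V-dec G i i) v u))
  ... | no i≢j   = trans (edge-sym G i j) (sym (subEdge′-≢ j i (≢-sym i≢j) (V-dec G j i) v u))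

  _⟨_⟩ˢ : SetGraph
  _⟨_⟩ˢ = record
    { V = Σ (V G) (λ i → V (H i)) ; V-dec = Product.≡-dec (V-dec G) (V-dec (H _))
    ; label = λ (i , u) → label (H i) u ; edge = subEdge
    ; edge-sym = subEdge-sym
    ; edge-irrefl = λ (i , u) → trans (subEdge′-≡ i (V-dec G i i) u u) (edge-irrefl (H i) u) }

pullbackˢ : (G : SetGraph) (W : Set) → DecidableEquality W → (W → V G) → SetGraph
pullbackˢ G W W-dec f = record
  { V = W ; V-dec = W-dec ; label = λ x → label G (f x) ; edge = λ x y → edge G (f x) (f y)
  ; edge-sym = λ x y → edge-sym G (f x) (f y) ; edge-irrefl = λ x → edge-irrefl G (f x) }

setGraph : Graph → SetGraph
setGraph G = record
  { V = Fin (size G) ; V-dec = Fin._≟_ ; label = lab G ; edge = adj G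
  ; edge-sym = adj-sym G ; edge-irrefl = adj-irrefl G }

pullback : (G : Graph) (k : ℕ) → (Fin k → Fin (size G)) → Graph
pullback G k f = record
  { size = k ; lab = λ x → lab G (f x) ; adj = λ x y → adj G (f x) (f y)
  ; adj-sym = λ x y → adj-sym G (f x) (f y) ; adj-irrefl = λ x → adj-irrefl G (f x) }

≃⇒≅ : ∀ {G H} → setGraph G ≃ setGraph H → G ≅ H
≃⇒≅ φ = record { iso = bij φ ; iso-lab = label-≡ φ ; iso-adj = edge-≡ φ }

≅⇒≃ : ∀ {G H} → G ≅ H → setGraph G ≃ setGraph H
≅⇒≃ i = record { bij = _≅_.iso i ; label-≡ = _≅_.iso-lab i ; edge-≡ = _≅_.iso-adj i }

setGraph-glue : ∀ G H c → setGraph (glue G H c) ≃ glueˢ (setGraph G) (setGraph H) c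
setGraph-glue G H c = record { bij = +↔⊎ ; label-≡ = label≡ ; edge-≡ = edge≡ }
  where
  label≡ : ∀ x → glueLabel (setGraph G) (setGraph H) c (splitAt (size G) x) ≡ lab (glue G H c) x
  label≡ x with splitAt (size G) x
  ... | inj₁ _ = refl
  ... | inj₂ _ = refl
  edge≡ : ∀ x y → glueEdge (setGraph G) (setGraph H) c (splitAt (size G) x) (splitAt (size G) y)
                ≡ adj (glue G H c) x y
  edge≡ x y with splitAt (size G) x | splitAt (size G) y
  ... | inj₁ _ | inj₁ _ = refl
  ... | inj₁ _ | inj₂ _ = refl
  ... | inj₂ _ | inj₁ _ = refl
  ... | inj₂ _ | inj₂ _ = refl

setGraph-dual : ∀ G → setGraph (dualG G) ≃ dualˢ (setGraph G)
setGraph-dual G = record { bij = ↔-refl ; label-≡ = λ _ → refl ; edge-≡ = edge≡ }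
  where
  edge≡ : ∀ x y → dualEdge (setGraph G) x y ≡ adj (dualG G) x y
  edge≡ x y with x Fin.≟ y
  ... | yes _ = refl
  ... | no _  = refl

encode : (n : ℕ) (s : Fin n → ℕ) → Σ (Fin n) (λ i → Fin (s i)) → Fin (∑ n s)
encode (suc n) s (zero  , u) = u ↑ˡ ∑ n (λ i → s (suc i))
encode (suc n) s (suc i , u) = s zero ↑ʳ encode n (λ i → s (suc i)) (i , u)

encode-decode : ∀ n s x → encode n s (decode n s x) ≡ x
encode-decode (suc n) s x
  with splitAt (s zero) x | join-splitAt (s zero) (∑ n (λ i → s (suc i))) x
... | inj₁ u | e = e
... | inj₂ y | e with decode n (λ i → s (suc i)) y | encode-decode n (λ i → s (suc i)) y
...   | i , v | e′ = trans (cong (s zero ↑ʳ_) e′) e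

decode-encode : ∀ n s p → decode n s (encode n s p) ≡ p
decode-encode (suc n) s (zero , u)
  rewrite splitAt-↑ˡ (s zero) u (∑ n (λ i → s (suc i))) = refl
decode-encode (suc n) s (suc i , u)
  rewrite splitAt-↑ʳ (s zero) (∑ n (λ i → s (suc i))) (encode n (λ i → s (suc i)) (i , u))
        | decode-encode n (λ i → s (suc i)) (i , u) = refl

setGraph-sub : ∀ G H → setGraph (G ⟨ H ⟩) ≃ setGraph G ⟨ (λ i → setGraph (H i)) ⟩ˢ
setGraph-sub G H = record
  { bij = mk↔ₛ′ (decode (size G) s) (encode (size G) s)
                (decode-encode (size G) s) (encode-decode (size G) s)
  ; label-≡ = λ _ → refl ; edge-≡ = edge≡ }
  where
  s = λ i → size (H i)
  edge≡ : ∀ x y → subEdge (setGraph G) (λ i → setGraph (H i)) (decode (size G) s x) (decode (size G) s y)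
                ≡ adj (G ⟨ H ⟩) x y
  edge≡ x y with decode (size G) s x | decode (size G) s y
  ... | i , u | j , v with i Fin.≟ j
  ...   | yes refl = refl
  ...   | no _     = refl

glueˢ-cong : ∀ {G G′ H H′ c c′} (φ : G ≃ G′) (ψ : H ≃ H′) →
  (∀ x y → c′ (to (bij φ) x) (to (bij ψ) y) ≡ c x y) → glueˢ G H c ≃ glueˢ G′ H′ c′
glueˢ-cong φ ψ c≡ = record
  { bij = bij φ ⊎-↔ bij ψ
  ; label-≡ = λ { (inj₁ x) → label-≡ φ x ; (inj₂ y) → label-≡ ψ y }
  ; edge-≡ = λ { (inj₁ x) (inj₁ x′) → edge-≡ φ x x′ ; (inj₁ x) (inj₂ y) → c≡ x y
               ; (inj₂ y) (inj₁ x) → c≡ x y ; (inj₂ y) (inj₂ y′) → edge-≡ ψ y y′ } }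

glueˢ-comm : ∀ G H c → glueˢ G H c ≃ glueˢ H G (λ y x → c x y)
glueˢ-comm G H c = record
  { bij = swap-↔
  ; label-≡ = λ { (inj₁ _) → refl ; (inj₂ _) → refl }
  ; edge-≡ = λ { (inj₁ _) (inj₁ _) → refl ; (inj₁ _) (inj₂ _) → refl
               ; (inj₂ _) (inj₁ _) → refl ; (inj₂ _) (inj₂ _) → refl } }

glueˢ-identityʳ : ∀ G E c → ¬ V E → glueˢ G E c ≃ G
glueˢ-identityʳ G E c ¬E = record
  { bij = mk↔ₛ′ from₁ inj₁ (λ _ → refl) λ { (inj₁ _) → refl ; (inj₂ e) → ⊥-elim (¬E e) }
  ; label-≡ = λ { (inj₁ _) → refl ; (inj₂ e) → ⊥-elim (¬E e) }
  ; edge-≡ = λ { (inj₁ _) (inj₁ _) → refl ; (inj₂ e) _ → ⊥-elim (¬E e) ; (inj₁ _) (inj₂ e) → ⊥-elim (¬E e) } }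
  where
  from₁ : V G ⊎ V E → V G
  from₁ (inj₁ x) = x
  from₁ (inj₂ e) = ⊥-elim (¬E e)

glueˢ-assoc : ∀ D E X (cEX : V E → V X → Bool) (cD : V D → V E ⊎ V X → Bool)
  (cDE : V D → V E → Bool) (cX : V D ⊎ V E → V X → Bool) →
  (∀ d e → cD d (inj₁ e) ≡ cDE d e) → (∀ d x → cD d (inj₂ x) ≡ cX (inj₁ d) x) →
  (∀ e x → cEX e x ≡ cX (inj₂ e) x) →
  glueˢ D (glueˢ E X cEX) cD ≃ glueˢ (glueˢ D E cDE) X cX
glueˢ-assoc D E X cEX cD cDE cX ≡DE ≡DX ≡EX = record
  { bij = ↔-sym (⊎-assoc _ (V D) (V E) (V X))
  ; label-≡ = λ { (inj₁ _) → refl ; (inj₂ (inj₁ _)) → refl ; (inj₂ (inj₂ _)) → refl }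
  ; edge-≡ = λ
      { (inj₁ d) (inj₁ d′) → refl
      ; (inj₁ d) (inj₂ (inj₁ e)) → sym (≡DE d e)
      ; (inj₁ d) (inj₂ (inj₂ x)) → sym (≡DX d x)
      ; (inj₂ (inj₁ e)) (inj₁ d) → sym (≡DE d e)
      ; (inj₂ (inj₁ e)) (inj₂ (inj₁ e′)) → refl
      ; (inj₂ (inj₁ e)) (inj₂ (inj₂ x)) → sym (≡EX e x)
      ; (inj₂ (inj₂ x)) (inj₁ d) → sym (≡DX d x)
      ; (inj₂ (inj₂ x)) (inj₂ (inj₁ e)) → sym (≡EX e x)
      ; (inj₂ (inj₂ x)) (inj₂ (inj₂ x′)) → refl } }

glueˢ-exchange : ∀ X Y Z c₁ c₂ c₃ c₄ →
  (∀ x y → c₁ x y ≡ c₄ (inj₁ x) y) → (∀ x z → c₂ (inj₁ x) z ≡ c₃ x z) →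
  (∀ y z → c₂ (inj₂ y) z ≡ c₄ (inj₂ z) y) →
  glueˢ (glueˢ X Y c₁) Z c₂ ≃ glueˢ (glueˢ X Z c₃) Y c₄
glueˢ-exchange X Y Z c₁ c₂ c₃ c₄ ≡XY ≡XZ ≡YZ = record
  { bij = mk↔ₛ′ exchange exchange⁻¹
      (λ { (inj₁ (inj₁ _)) → refl ; (inj₁ (inj₂ _)) → refl ; (inj₂ _) → refl })
      (λ { (inj₁ (inj₁ _)) → refl ; (inj₁ (inj₂ _)) → refl ; (inj₂ _) → refl })
  ; label-≡ = λ { (inj₁ (inj₁ _)) → refl ; (inj₁ (inj₂ _)) → refl ; (inj₂ _) → refl }
  ; edge-≡ = λ
      { (inj₁ (inj₁ x)) (inj₁ (inj₁ x′)) → refl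
      ; (inj₁ (inj₁ x)) (inj₁ (inj₂ y)) → sym (≡XY x y)
      ; (inj₁ (inj₁ x)) (inj₂ z) → sym (≡XZ x z)
      ; (inj₁ (inj₂ y)) (inj₁ (inj₁ x)) → sym (≡XY x y)
      ; (inj₁ (inj₂ y)) (inj₁ (inj₂ y′)) → refl
      ; (inj₁ (inj₂ y)) (inj₂ z) → sym (≡YZ y z)
      ; (inj₂ z) (inj₁ (inj₁ x)) → sym (≡XZ x z)
      ; (inj₂ z) (inj₁ (inj₂ y)) → sym (≡YZ y z)
      ; (inj₂ z) (inj₂ z′) → refl } }
  where
  exchange : (V X ⊎ V Y) ⊎ V Z → (V X ⊎ V Z) ⊎ V Y
  exchange (inj₁ (inj₁ x)) = inj₁ (inj₁ x)
  exchange (inj₁ (inj₂ y)) = inj₂ y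
  exchange (inj₂ z)        = inj₁ (inj₂ z)
  exchange⁻¹ : (V X ⊎ V Z) ⊎ V Y → (V X ⊎ V Y) ⊎ V Z
  exchange⁻¹ (inj₁ (inj₁ x)) = inj₁ (inj₁ x)
  exchange⁻¹ (inj₁ (inj₂ z)) = inj₂ z
  exchange⁻¹ (inj₂ y)        = inj₁ (inj₂ y)

≃-empty : ∀ {G H} → ¬ V G → ¬ V H → G ≃ H
≃-empty ¬G ¬H = record
  { bij = mk↔ₛ′ (λ x → ⊥-elim (¬G x)) (λ y → ⊥-elim (¬H y)) (λ y → ⊥-elim (¬H y)) (λ x → ⊥-elim (¬G x))
  ; label-≡ = λ x → ⊥-elim (¬G x) ; edge-≡ = λ x → ⊥-elim (¬G x) }

dualˢ-cong : ∀ {G G′} → G ≃ G′ → dualˢ G ≃ dualˢ G′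
dualˢ-cong {G} {G′} φ = record
  { bij = bij φ
  ; label-≡ = λ x → cong dual (label-≡ φ x)
  ; edge-≡ = λ x y → complementEdge-cong (V-dec G′ _ _) (V-dec G x y)
                       (↔-injective (bij φ)) (cong (to (bij φ))) (edge-≡ φ x y) }

dualˢ-glueˢ : ∀ X Y c → dualˢ (glueˢ X Y c) ≃ glueˢ (dualˢ X) (dualˢ Y) (λ x y → not (c x y))
dualˢ-glueˢ X Y c = record
  { bij = ↔-refl
  ; label-≡ = λ { (inj₁ _) → refl ; (inj₂ _) → refl }
  ; edge-≡ = edge≡ }
  where
  edge≡ : ∀ p q → _
  edge≡ (inj₁ x) (inj₁ x′) with V-dec X x x′
  ... | yes refl = refl
  ... | no _     = refl
  edge≡ (inj₂ y) (inj₂ y′) with V-dec Y y y′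
  ... | yes refl = refl
  ... | no _     = refl
  edge≡ (inj₁ x) (inj₂ y) = refl
  edge≡ (inj₂ y) (inj₁ x) = refl

dualˢ-pullbackˢ : ∀ {G W W-dec} (f : W → V G) → (∀ {x y} → f x ≡ f y → x ≡ y) →
  dualˢ (pullbackˢ G W W-dec f) ≃ pullbackˢ (dualˢ G) W W-dec f
dualˢ-pullbackˢ {G} {W} {W-dec} f f-inj = record
  { bij = ↔-refl ; label-≡ = λ _ → refl
  ; edge-≡ = λ x y → complementEdge-cong (V-dec G (f x) (f y)) (W-dec x y) f-inj (cong f) refl }

pullbackˢ-reindex : ∀ {G W W′ W-dec W′-dec} (g : W′ → V G) (e : W ↔ W′) →
  pullbackˢ G W W-dec (λ x → g (to e x)) ≃ pullbackˢ G W′ W′-dec g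
pullbackˢ-reindex g e = record { bij = e ; label-≡ = λ _ → refl ; edge-≡ = λ _ _ → refl }

subˢ-congʳ : ∀ {G} {H H′ : V G → SetGraph} → (∀ i → H i ≃ H′ i) → G ⟨ H ⟩ˢ ≃ G ⟨ H′ ⟩ˢ
subˢ-congʳ {G} {H} {H′} φ = record
  { bij = mk↔ₛ′ (λ (i , u) → i , to (bij (φ i)) u) (λ (i , u) → i , from (bij (φ i)) u)
                (λ (i , u) → cong (i ,_) (strictlyInverseˡ (bij (φ i)) u))
                (λ (i , u) → cong (i ,_) (strictlyInverseʳ (bij (φ i)) u))
  ; label-≡ = λ (i , u) → label-≡ (φ i) u
  ; edge-≡ = edge≡ }
  where
  edge≡ : ∀ p q → _
  edge≡ (i , u) (j , v) with V-dec G i j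
  ... | yes refl = edge-≡ (φ i) u v
  ... | no _     = refl

private
  Σ-≡-transport : ∀ {A B : Set} {P : B → Set} (f : A → B) {a b : A} (e : a ≡ b) (e′ : f a ≡ f b)
    (u : P (f b)) → _≡_ {A = Σ A (λ x → P (f x))} (a , subst P (sym e′) u) (b , u)
  Σ-≡-transport f refl refl u = refl

subˢ-reindex : ∀ {G G′} (φ : G ≃ G′) (H : V G′ → SetGraph) →
  G ⟨ (λ i → H (to (bij φ) i)) ⟩ˢ ≃ G′ ⟨ H ⟩ˢ
subˢ-reindex {G} {G′} φ H = record
  { bij = mk↔ₛ′ (λ (i , u) → to b i , u)
                (λ (j , u) → from b j , subst (λ j → V (H j)) (sym (strictlyInverseˡ b j)) u)
                (λ (j , u) → Σ-≡-transport (λ x → x) (strictlyInverseˡ b j) (strictlyInverseˡ b j) u)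
                (λ (i , u) → Σ-≡-transport (to b) (strictlyInverseʳ b i) (strictlyInverseˡ b (to b i)) u)
  ; label-≡ = λ _ → refl ; edge-≡ = edge≡ }
  where
  b = bij φ
  edge≡ : ∀ p q → _
  edge≡ (i , u) (j , v) with V-dec G i j
  ... | yes refl = subEdge′-≡ G′ H (to b i) (V-dec G′ _ _) u v
  ... | no i≢j   = trans (subEdge′-≢ G′ H (to b i) (to b j) (λ e → i≢j (↔-injective b e)) (V-dec G′ _ _) u v)
                         (edge-≡ φ i j)

subˢ-glueˢ : ∀ X Y c (H : V X ⊎ V Y → SetGraph) →
  glueˢ X Y c ⟨ H ⟩ˢ
    ≃ glueˢ (X ⟨ (λ x → H (inj₁ x)) ⟩ˢ) (Y ⟨ (λ y → H (inj₂ y)) ⟩ˢ) (λ p q → c (proj₁ p) (proj₁ q))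
subˢ-glueˢ X Y c H = record
  { bij = mk↔ₛ′ distrib distrib⁻¹
      (λ { (inj₁ _) → refl ; (inj₂ _) → refl }) (λ { (inj₁ _ , _) → refl ; (inj₂ _ , _) → refl })
  ; label-≡ = λ { (inj₁ _ , _) → refl ; (inj₂ _ , _) → refl }
  ; edge-≡ = edge≡ }
  where
  XY = glueˢ X Y c
  distrib : Σ (V X ⊎ V Y) (λ w → V (H w)) → _
  distrib (inj₁ x , u) = inj₁ (x , u)
  distrib (inj₂ y , u) = inj₂ (y , u)
  distrib⁻¹ : _ → Σ (V X ⊎ V Y) (λ w → V (H w))
  distrib⁻¹ (inj₁ (x , u)) = inj₁ x , u
  distrib⁻¹ (inj₂ (y , u)) = inj₂ y , u
  sameSide : ∀ {Z} (ι : V Z → V X ⊎ V Y) → (∀ {z z′} → ι z ≡ ι z′ → z ≡ z′) →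
    (∀ z z′ → edge Z z z′ ≡ edge XY (ι z) (ι z′)) →
    ∀ z z′ u u′ → (z≟z′ : Dec (z ≡ z′)) →
    subEdge′ Z (λ z → H (ι z)) z z′ z≟z′ u u′ ≡ subEdge XY H (ι z , u) (ι z′ , u′)
  sameSide ι ι-inj ≡edge z .z u u′ (yes refl) =
    sym (subEdge′-≡ XY H (ι z) (V-dec XY (ι z) (ι z)) u u′)
  sameSide ι ι-inj ≡edge z z′ u u′ (no z≢z′) =
    trans (≡edge z z′) (sym (subEdge′-≢ XY H (ι z) (ι z′) (λ e → z≢z′ (ι-inj e)) (V-dec XY _ _) u u′))
  edge≡ : ∀ p q → _
  edge≡ (inj₁ x , u) (inj₁ x′ , u′) = sameSide inj₁ (λ { refl → refl }) (λ _ _ → refl) x x′ u u′ (V-dec X x x′)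
  edge≡ (inj₂ y , u) (inj₂ y′ , u′) = sameSide inj₂ (λ { refl → refl }) (λ _ _ → refl) y y′ u u′ (V-dec Y y y′)
  edge≡ (inj₁ x , u) (inj₂ y , u′) = sym (subEdge′-≢ XY H (inj₁ x) (inj₂ y) (λ ()) (V-dec XY _ _) u u′)
  edge≡ (inj₂ y , u) (inj₁ x , u′) = sym (subEdge′-≢ XY H (inj₂ y) (inj₁ x) (λ ()) (V-dec XY _ _) u u′)

subˢ-atoms : ∀ G → G ⟨ (λ x → setGraph (atomG (label G x))) ⟩ˢ ≃ G
subˢ-atoms G = record
  { bij = mk↔ₛ′ proj₁ (λ x → x , zero) (λ _ → refl) (λ { (x , zero) → refl })
  ; label-≡ = λ _ → refl ; edge-≡ = edge≡ }
  where
  edge≡ : ∀ p q → _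
  edge≡ (x , zero) (y , zero) with V-dec G x y
  ... | yes refl = edge-irrefl G x
  ... | no _     = refl

glueˢ-sub-atoms : ∀ C P (R : V C → Bool) (X : V P → Graph) →
  glueˢ C P (λ c _ → R c) ⟨ (λ w → setGraph (Data.Sum.[ (λ c → atomG (label C c)) , X ] w)) ⟩ˢ
    ≃ glueˢ C (P ⟨ (λ p → setGraph (X p)) ⟩ˢ) (λ c _ → R c)
glueˢ-sub-atoms C P R X =
  ≃-trans (subˢ-glueˢ C P _ _) (glueˢ-cong (subˢ-atoms C) ≃-refl (λ _ _ → refl))

subˢ-singleton : ∀ (Q : Graph) → size Q ≡ 1 → ∀ c (H : Fin (size Q) → SetGraph) →
  setGraph Q ⟨ H ⟩ˢ ≃ H c
subˢ-singleton record { size = 1 } refl zero H = record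
  { bij = mk↔ₛ′ (λ { (zero , u) → u }) (zero ,_) (λ _ → refl) (λ { (zero , u) → refl })
  ; label-≡ = λ { (zero , u) → refl }
  ; edge-≡ = λ { (zero , u) (zero , v) → refl } }

subˢ-pair : ∀ {l a s i} (H : Fin 2 → SetGraph) →
  let Q = record { size = 2 ; lab = l ; adj = a ; adj-sym = s ; adj-irrefl = i } in
  setGraph Q ⟨ H ⟩ˢ ≃ glueˢ (H zero) (H (suc zero)) (λ _ _ → a zero (suc zero))
subˢ-pair {a = a} {s = s} H = record
  { bij = mk↔ₛ′ split unsplit (λ { (inj₁ _) → refl ; (inj₂ _) → refl })
                              (λ { (zero , _) → refl ; (suc zero , _) → refl })
  ; label-≡ = λ { (zero , _) → refl ; (suc zero , _) → refl }
  ; edge-≡ = λ { (zero , _) (zero , _) → refl ; (zero , _) (suc zero , _) → refl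
               ; (suc zero , _) (zero , _) → s zero (suc zero) ; (suc zero , _) (suc zero , _) → refl } }
  where
  split : Σ (Fin 2) (λ i → V (H i)) → V (H zero) ⊎ V (H (suc zero))
  split (zero , u)     = inj₁ u
  split (suc zero , u) = inj₂ u
  unsplit : V (H zero) ⊎ V (H (suc zero)) → Σ (Fin 2) (λ i → V (H i))
  unsplit (inj₁ u) = zero , u
  unsplit (inj₂ u) = suc zero , u

-- S is a module of G with representative r: quotient is G/S, with S collapsed to r, and
-- inside is G|S.
module Collapse (G : SetGraph) (S : V G → Bool) (r : V G) (r∈S : S r ≡ true)
  (module-edge : ∀ v x → S v ≡ false → S x ≡ true → edge G v x ≡ edge G v r) where

  Quotient : Set
  Quotient = ⊤ ⊎ Fiber S false

  Quotient-dec : DecidableEquality Quotient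
  Quotient-dec = Sum.≡-dec (λ { tt tt → yes refl }) (Fiber-dec (V-dec G))

  embed : Quotient → V G
  embed = Data.Sum.[ (λ _ → r) , proj₁ ]

  embed-injective : ∀ {x y} → embed x ≡ embed y → x ≡ y
  embed-injective {inj₁ tt} {inj₁ tt} _ = refl
  embed-injective {inj₁ tt} {inj₂ (y , q)} refl with trans (sym r∈S) q
  ... | ()
  embed-injective {inj₂ (x , p)} {inj₁ tt} refl with trans (sym r∈S) p
  ... | ()
  embed-injective {inj₂ (x , p)} {inj₂ (.x , q)} refl = cong inj₂ (Fiber-≡ refl)

  inside : SetGraph
  inside = pullbackˢ G (Fiber S true) (Fiber-dec (V-dec G)) proj₁

  quotient : SetGraph
  quotient = pullbackˢ G Quotient Quotient-dec embed

  module _ (H : V G → SetGraph) where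

    collapsed : Quotient → SetGraph
    collapsed (inj₁ _) = inside ⟨ (λ p → H (proj₁ p)) ⟩ˢ
    collapsed (inj₂ p) = H (proj₁ p)

    private
      Flat = Σ (V G) (λ i → V (H i))
      Nested = Σ Quotient (λ w → V (collapsed w))

      nest : ∀ i → V (H i) → (b : Bool) → S i ≡ b → Nested
      nest i u true  p = inj₁ tt , ((i , p) , u)
      nest i u false p = inj₂ (i , p) , u

      flatten : Nested → Flat
      flatten (inj₁ tt , ((i , _) , u)) = i , u
      flatten (inj₂ (i , _) , u)        = i , u

      nest-canonical : ∀ i u b (p : S i ≡ b) → nest i u b p ≡ nest i u (S i) refl
      nest-canonical i u b refl = refl

      nest-flatten : ∀ y → nest (proj₁ (flatten y)) (proj₂ (flatten y)) _ refl ≡ y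
      nest-flatten (inj₁ tt , ((i , p) , u)) = sym (nest-canonical i u true p)
      nest-flatten (inj₂ (i , p) , u)        = sym (nest-canonical i u false p)

      flatten-nest : ∀ i u b p → flatten (nest i u b p) ≡ (i , u)
      flatten-nest i u true  _ = refl
      flatten-nest i u false _ = refl

      nest-label : ∀ i u b p → label (quotient ⟨ collapsed ⟩ˢ) (nest i u b p) ≡ label (H i) u
      nest-label i u true  _ = refl
      nest-label i u false _ = refl

      different : ∀ {i j} → S i ≡ true → S j ≡ false → i ≢ j
      different p q refl with trans (sym p) q
      ... | ()

      insideEdge : ∀ i j (p : S i ≡ true) (q : S j ≡ true) u v → Dec (i ≡ j) →
        edge (collapsed (inj₁ tt)) ((i , p) , u) ((j , q) , v) ≡ subEdge G H (i , u) (j , v)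
      insideEdge i .i p q u v (yes refl) rewrite uip p q =
        trans (subEdge′-≡ inside _ (i , q) (Fiber-dec (V-dec G) (i , q) (i , q)) u v)
              (sym (subEdge′-≡ G H i (V-dec G i i) u v))
      insideEdge i j p q u v (no i≢j) =
        trans (subEdge′-≢ inside _ (i , p) (j , q) (λ e → i≢j (cong proj₁ e)) (Fiber-dec (V-dec G) _ _) u v)
              (sym (subEdge′-≢ G H i j i≢j (V-dec G i j) u v))

      outsideEdge : ∀ i j (p : S i ≡ false) (q : S j ≡ false) u v → Dec (i ≡ j) →
        edge (quotient ⟨ collapsed ⟩ˢ) (inj₂ (i , p) , u) (inj₂ (j , q) , v) ≡ subEdge G H (i , u) (j , v)
      outsideEdge i .i p q u v (yes refl) rewrite uip p q =
        trans (subEdge′-≡ quotient collapsed (inj₂ (i , q)) (Quotient-dec _ _) u v)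
              (sym (subEdge′-≡ G H i (V-dec G i i) u v))
      outsideEdge i j p q u v (no i≢j) =
        trans (subEdge′-≢ quotient collapsed (inj₂ (i , p)) (inj₂ (j , q)) (λ e → i≢j (cong embed e))
                          (Quotient-dec _ _) u v)
              (sym (subEdge′-≢ G H i j i≢j (V-dec G i j) u v))

      nest-edge : ∀ i u j v bi (p : S i ≡ bi) bj (q : S j ≡ bj) →
        edge (quotient ⟨ collapsed ⟩ˢ) (nest i u bi p) (nest j v bj q) ≡ subEdge G H (i , u) (j , v)
      nest-edge i u j v true p true q
        rewrite subEdge′-≡ quotient collapsed (inj₁ tt) (Quotient-dec _ _) ((i , p) , u) ((j , q) , v)
        = insideEdge i j p q u v (V-dec G i j)
      nest-edge i u j v true p false q =
        trans (subEdge′-≢ quotient collapsed (inj₁ tt) (inj₂ (j , q)) (λ ()) (Quotient-dec _ _) ((i , p) , u) v)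
        (trans (edge-sym G r j) (trans (sym (module-edge j i q p)) (trans (edge-sym G j i)
          (sym (subEdge′-≢ G H i j (different p q) (V-dec G i j) u v)))))
      nest-edge i u j v false p true q =
        trans (subEdge′-≢ quotient collapsed (inj₂ (i , p)) (inj₁ tt) (λ ()) (Quotient-dec _ _) u ((j , q) , v))
        (trans (sym (module-edge i j p q))
          (sym (subEdge′-≢ G H i j (≢-sym (different q p)) (V-dec G i j) u v)))
      nest-edge i u j v false p false q = outsideEdge i j p q u v (V-dec G i j)

    collapse : G ⟨ H ⟩ˢ ≃ quotient ⟨ collapsed ⟩ˢ
    collapse = record
      { bij = mk↔ₛ′ (λ (i , u) → nest i u _ refl) flatten nest-flatten (λ (i , u) → flatten-nest i u _ refl)
      ; label-≡ = λ (i , u) → nest-label i u _ refl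
      ; edge-≡ = λ (i , u) (j , v) → nest-edge i u j v _ refl _ refl }

module-edge-dual : ∀ (G : SetGraph) (S : V G → Bool) r → S r ≡ true →
  (∀ v x → S v ≡ false → S x ≡ true → edge G v x ≡ edge G v r) →
  ∀ v x → S v ≡ false → S x ≡ true → edge (dualˢ G) v x ≡ edge (dualˢ G) v r
module-edge-dual G S r r∈S module-edge v x v∉S x∈S with V-dec G v x | V-dec G v r
... | yes refl | _ with trans (sym v∉S) x∈S
...   | ()
module-edge-dual G S r r∈S module-edge v x v∉S x∈S | no _ | yes refl with trans (sym v∉S) r∈S
...   | ()
module-edge-dual G S r r∈S module-edge v x v∉S x∈S | no _ | no _ = cong not (module-edge v x v∉S x∈S)

≅-refl : ∀ {G} → G ≅ G
≅-refl = ≃⇒≅ ≃-refl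

≅-sym : ∀ {G H} → G ≅ H → H ≅ G
≅-sym i = ≃⇒≅ (≃-sym (≅⇒≃ i))

≅-trans : ∀ {G H K} → G ≅ H → H ≅ K → G ≅ K
≅-trans i j = ≃⇒≅ (≃-trans (≅⇒≃ i) (≅⇒≃ j))

≅-isEquivalence : IsEquivalence _≅_
≅-isEquivalence = record { refl = ≅-refl ; sym = ≅-sym ; trans = ≅-trans }

module _ (b : Bool) where
  private
    const : ∀ {A B : Set} → A → B → Bool
    const _ _ = b

  constGlue-cong : ∀ {G G′ H H′} → G ≅ G′ → H ≅ H′ → glue G H const ≅ glue G′ H′ const
  constGlue-cong {G} {G′} {H} {H′} i j = ≃⇒≅ (begin
    setGraph (glue G H const)               ≈⟨ setGraph-glue G H const ⟩
    glueˢ (setGraph G) (setGraph H) const   ≈⟨ glueˢ-cong (≅⇒≃ i) (≅⇒≃ j) (λ _ _ → refl) ⟩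
    glueˢ (setGraph G′) (setGraph H′) const ≈⟨ setGraph-glue G′ H′ const ⟨
    setGraph (glue G′ H′ const)             ∎)
    where open ≃-Reasoning

  constGlue-comm : ∀ G H → glue G H const ≅ glue H G const
  constGlue-comm G H = ≃⇒≅ (begin
    setGraph (glue G H const)             ≈⟨ setGraph-glue G H const ⟩
    glueˢ (setGraph G) (setGraph H) const ≈⟨ glueˢ-comm _ _ const ⟩
    glueˢ (setGraph H) (setGraph G) const ≈⟨ setGraph-glue H G const ⟨
    setGraph (glue H G const)             ∎)
    where open ≃-Reasoning

  constGlue-assoc : ∀ G H L → glue (glue G H const) L const ≅ glue G (glue H L const) const
  constGlue-assoc G H L = ≃⇒≅ (begin
    setGraph (glue (glue G H const) L const)
      ≈⟨ setGraph-glue _ L const ⟩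
    glueˢ (setGraph (glue G H const)) (setGraph L) const
      ≈⟨ glueˢ-cong (setGraph-glue G H const) ≃-refl (λ _ _ → refl) ⟩
    glueˢ (glueˢ (setGraph G) (setGraph H) const) (setGraph L) const
      ≈⟨ glueˢ-assoc (setGraph G) (setGraph H) (setGraph L) const const const const
                     (λ _ _ → refl) (λ _ _ → refl) (λ _ _ → refl) ⟨
    glueˢ (setGraph G) (glueˢ (setGraph H) (setGraph L) const) const
      ≈⟨ glueˢ-cong ≃-refl (setGraph-glue H L const) (λ _ _ → refl) ⟨
    glueˢ (setGraph G) (setGraph (glue H L const)) const
      ≈⟨ setGraph-glue G _ const ⟨
    setGraph (glue G (glue H L const) const)
      ∎)
    where open ≃-Reasoning

⊔-cong : ∀ {G G′ H H′} → G ≅ G′ → H ≅ H′ → (G ⊔ H) ≅ (G′ ⊔ H′)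
⊔-cong = constGlue-cong false

⊔-comm : ∀ G H → (G ⊔ H) ≅ (H ⊔ G)
⊔-comm = constGlue-comm false

⊔-assoc : ∀ G H L → ((G ⊔ H) ⊔ L) ≅ (G ⊔ (H ⊔ L))
⊔-assoc = constGlue-assoc false

⊗-cong : ∀ {G G′ H H′} → G ≅ G′ → H ≅ H′ → (G ⊗ H) ≅ (G′ ⊗ H′)
⊗-cong = constGlue-cong true

⊗-comm : ∀ G H → (G ⊗ H) ≅ (H ⊗ G)
⊗-comm = constGlue-comm true

dualG-cong : ∀ {X Y} → X ≅ Y → dualG X ≅ dualG Y
dualG-cong {X} {Y} i =
  ≃⇒≅ (≃-trans (setGraph-dual X) (≃-trans (dualˢ-cong (≅⇒≃ i)) (≃-sym (setGraph-dual Y))))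

plug-cong : ∀ {X Y} D T → X ≅ Y → (D [ X ]⟨ T ⟩) ≅ (D [ Y ]⟨ T ⟩)
plug-cong {X} {Y} D T i = ≃⇒≅ (begin
  setGraph (D [ X ]⟨ T ⟩)                ≈⟨ setGraph-glue D X _ ⟩
  glueˢ (setGraph D) (setGraph X) (λ d _ → T d) ≈⟨ glueˢ-cong ≃-refl (≅⇒≃ i) (λ _ _ → refl) ⟩
  glueˢ (setGraph D) (setGraph Y) (λ d _ → T d) ≈⟨ setGraph-glue D Y _ ⟨
  setGraph (D [ Y ]⟨ T ⟩)                ∎)
  where open ≃-Reasoning

composeContexts : (D E : Graph) → (Fin (size D) → Bool) → (Fin (size E) → Bool) →
  Fin (size D + size E) → Bool
composeContexts D E T U z = Data.Sum.[ T , U ] (splitAt (size D) z)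

plug-plug : ∀ D E X T U →
  (D [ E [ X ]⟨ U ⟩ ]⟨ T ⟩) ≅ ((D [ E ]⟨ T ⟩) [ X ]⟨ composeContexts D E T U ⟩)
plug-plug D E X T U = ≃⇒≅ (begin
  setGraph (D [ E [ X ]⟨ U ⟩ ]⟨ T ⟩)
    ≈⟨ setGraph-glue D _ _ ⟩
  glueˢ (setGraph D) (setGraph (E [ X ]⟨ U ⟩)) _
    ≈⟨ glueˢ-cong ≃-refl (setGraph-glue E X _) (λ _ _ → refl) ⟩
  glueˢ (setGraph D) (glueˢ (setGraph E) (setGraph X) (λ e _ → U e)) _
    ≈⟨ glueˢ-assoc (setGraph D) (setGraph E) (setGraph X) _ _ (λ d _ → T d) (λ z _ → Data.Sum.[ T , U ] z)
                   (λ _ _ → refl) (λ _ _ → refl) (λ _ _ → refl) ⟩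
  glueˢ (glueˢ (setGraph D) (setGraph E) (λ d _ → T d)) (setGraph X) (λ z _ → Data.Sum.[ T , U ] z)
    ≈⟨ glueˢ-cong (setGraph-glue D E _) ≃-refl (λ _ _ → refl) ⟨
  glueˢ (setGraph (D [ E ]⟨ T ⟩)) (setGraph X) _
    ≈⟨ setGraph-glue (D [ E ]⟨ T ⟩) X _ ⟨
  setGraph ((D [ E ]⟨ T ⟩) [ X ]⟨ composeContexts D E T U ⟩)
    ∎)
  where open ≃-Reasoning

glue-emptyˡ : ∀ {G} H c → ¬ Fin (size G) → glue G H c ≅ H
glue-emptyˡ {G} H c ¬G = ≃⇒≅ (begin
  setGraph (glue G H c)                             ≈⟨ setGraph-glue G H c ⟩
  glueˢ (setGraph G) (setGraph H) c                 ≈⟨ glueˢ-comm _ _ c ⟩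
  glueˢ (setGraph H) (setGraph G) (λ y x → c x y)   ≈⟨ glueˢ-identityʳ _ _ _ ¬G ⟩
  setGraph H                                        ∎)
  where open ≃-Reasoning

glue-emptyʳ : ∀ G {H} c → ¬ Fin (size H) → glue G H c ≅ G
glue-emptyʳ G {H} c ¬H = ≃⇒≅ (≃-trans (setGraph-glue G H c) (glueˢ-identityʳ _ _ c ¬H))

-- Derivability in context

-- Y may replace X inside every context. Quantifying over contexts is what makes ⇝ stable under
-- plugging (⇝-plug); ⊢ X amounts to ∅ ⇝ X.
infix 4 _⇝_
_⇝_ : Graph → Graph → Set
X ⇝ Y = ∀ D T → ⊢GS (D [ X ]⟨ T ⟩) → ⊢GS (D [ Y ]⟨ T ⟩)

⊢-≅ : ∀ {X Y} → ⊢GS X → X ≅ Y → ⊢GS Y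
⊢-≅ d i = d ◅◅ (isoStep i ◅ ε)

⇝-trans : ∀ {X Y Z} → X ⇝ Y → Y ⇝ Z → X ⇝ Z
⇝-trans X⇝Y Y⇝Z D T = Y⇝Z D T ∘′ X⇝Y D T

≅⇒⇝ : ∀ {X Y} → X ≅ Y → X ⇝ Y
≅⇒⇝ i D T d = ⊢-≅ d (plug-cong D T i)

⇝-preorder : Preorder _ _ _
⇝-preorder = record
  { Carrier = Graph ; _≈_ = _≅_ ; _≲_ = _⇝_
  ; isPreorder = record { isEquivalence = ≅-isEquivalence ; reflexive = ≅⇒⇝ ; trans = ⇝-trans } }

module ⇝-Reasoning = Relation.Binary.Reasoning.Preorder ⇝-preorder

⇝-plug : ∀ {X Y} E U → X ⇝ Y → (E [ X ]⟨ U ⟩) ⇝ (E [ Y ]⟨ U ⟩)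
⇝-plug {X} {Y} E U X⇝Y D T d =
  ⊢-≅ (X⇝Y (D [ E ]⟨ T ⟩) (composeContexts D E T U) (⊢-≅ d (plug-plug D E X T U)))
      (≅-sym (plug-plug D E Y T U))

rule⇒⇝ : ∀ {X Y} → Rule X Y → X ⇝ Y
rule⇒⇝ {X} {Y} r D T d = d ◅◅ (ruleStep D T X Y r ≅-refl ≅-refl ◅ ε)

step⇒⇝ : ∀ {Z Z′} → Step Z Z′ → Z ⇝ Z′
step⇒⇝ (isoStep i) = ≅⇒⇝ i
step⇒⇝ (ruleStep D T X Y r Z≅ Z′≅) =
  ⇝-trans (≅⇒⇝ Z≅) (⇝-trans (⇝-plug D T (rule⇒⇝ r)) (≅⇒⇝ (≅-sym Z′≅)))

star⇒⇝ : ∀ {Z X} → Star Step Z X → Z ⇝ X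
star⇒⇝ ε          D T d = d
star⇒⇝ (s ◅ steps) = ⇝-trans (step⇒⇝ s) (star⇒⇝ steps)

⊢⇒∅⇝ : ∀ {X} → ⊢GS X → emptyG ⇝ X
⊢⇒∅⇝ = star⇒⇝

∅⇝⇒⊢ : ∀ {X} → emptyG ⇝ X → ⊢GS X
∅⇝⇒⊢ {X} ∅⇝X =
  ⊢-≅ (∅⇝X emptyG (λ ()) (⊢-≅ ε (≅-sym (glue-emptyˡ {emptyG} emptyG (λ ()) (λ ())))))
      (glue-emptyˡ {emptyG} X (λ ()) (λ ()))

Fin-empty-or-nonempty : ∀ n → ¬ Fin n ⊎ 0 < n
Fin-empty-or-nonempty zero    = inj₁ (λ ())
Fin-empty-or-nonempty (suc n) = inj₂ (s≤s z≤n)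

plug-respects : ∀ D X {T T′ : Fin (size D) → Bool} → (Fin (size X) → ∀ d → T d ≡ T′ d) →
  (D [ X ]⟨ T ⟩) ≅ (D [ X ]⟨ T′ ⟩)
plug-respects D X T≗T′ = ≃⇒≅ (≃-trans (setGraph-glue D X _)
  (≃-trans (glueˢ-cong ≃-refl ≃-refl (λ d x → sym (T≗T′ x d))) (≃-sym (setGraph-glue D X _))))

fromRight : (X Z : Graph) → Fin (size X + size Z) → Bool
fromRight X Z w = Data.Sum.[ (λ _ → false) , (λ _ → true) ] (splitAt (size X) w)

switch-shape : ∀ X Y Z → ((X ⊔ Y) ⊗ Z) ≅ ((X ⊗ Z) [ Y ]⟨ fromRight X Z ⟩)
switch-shape X Y Z = ≃⇒≅ (begin
  setGraph ((X ⊔ Y) ⊗ Z)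
    ≈⟨ setGraph-glue _ Z _ ⟩
  glueˢ (setGraph (X ⊔ Y)) (setGraph Z) _
    ≈⟨ glueˢ-cong (setGraph-glue X Y _) ≃-refl (λ _ _ → refl) ⟩
  glueˢ (glueˢ (setGraph X) (setGraph Y) _) (setGraph Z) (λ _ _ → true)
    ≈⟨ glueˢ-exchange (setGraph X) (setGraph Y) (setGraph Z) _ _ (λ _ _ → true)
                      (λ u _ → Data.Sum.[ (λ _ → false) , (λ _ → true) ] u)
                      (λ _ _ → refl) (λ _ _ → refl) (λ _ _ → refl) ⟩
  glueˢ (glueˢ (setGraph X) (setGraph Z) _) (setGraph Y) _
    ≈⟨ glueˢ-cong (setGraph-glue X Z _) ≃-refl (λ _ _ → refl) ⟨
  glueˢ (setGraph (X ⊗ Z)) (setGraph Y) _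
    ≈⟨ setGraph-glue _ Y _ ⟨
  setGraph ((X ⊗ Z) [ Y ]⟨ fromRight X Z ⟩)
    ∎)
  where open ≃-Reasoning

switch : ∀ X Y Z → ((X ⊔ Y) ⊗ Z) ⇝ ((X ⊗ Z) ⊔ Y)
switch X Y Z = ⇝-trans (≅⇒⇝ (switch-shape X Y Z))
                       (apply (Fin-empty-or-nonempty (size Y)) (Fin-empty-or-nonempty (size Z)))
  where
  apply : ¬ Fin (size Y) ⊎ 0 < size Y → ¬ Fin (size Z) ⊎ 0 < size Z →
          ((X ⊗ Z) [ Y ]⟨ fromRight X Z ⟩) ⇝ ((X ⊗ Z) ⊔ Y)
  -- ss↓ needs Y and Z nonempty; otherwise both sides are already isomorphic.
  apply (inj₁ Y≡∅) _ = ≅⇒⇝ (plug-respects (X ⊗ Z) Y (λ y → ⊥-elim (Y≡∅ y)))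
  apply (inj₂ _) (inj₁ Z≡∅) = ≅⇒⇝ (plug-respects (X ⊗ Z) Y (λ _ → notFromRight))
    where
    notFromRight : ∀ w → fromRight X Z w ≡ false
    notFromRight w with splitAt (size X) w
    ... | inj₁ _ = refl
    ... | inj₂ z = ⊥-elim (Z≡∅ z)
  apply (inj₂ Y≢∅) (inj₂ Z≢∅) =
    rule⇒⇝ (ss↓ (X ⊗ Z) Y (fromRight X Z) (size X ↑ʳ z , fromRight-z) Y≢∅)
    where
    z = Fin.fromℕ< Z≢∅
    fromRight-z : fromRight X Z (size X ↑ʳ z) ≡ true
    fromRight-z rewrite splitAt-↑ʳ (size X) (size Z) z = refl

∅⇝-tensor : ∀ {X Y} → emptyG ⇝ X → emptyG ⇝ Y → emptyG ⇝ (X ⊗ Y)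
∅⇝-tensor {X} {Y} ∅⇝X ∅⇝Y = begin
  emptyG              ≲⟨ ∅⇝X ⟩
  X                   ≈⟨ glue-emptyʳ X _ (λ ()) ⟨
  X ⊗ emptyG          ≲⟨ ⇝-plug X (λ _ → true) ∅⇝Y ⟩
  X ⊗ Y               ∎
  where open ⇝-Reasoning

∅⇝-tensorPairs : ∀ A₀ B₀ A₁ B₁ → emptyG ⇝ (A₀ ⊔ B₀) → emptyG ⇝ (A₁ ⊔ B₁) →
  emptyG ⇝ ((A₀ ⊔ A₁) ⊔ (B₀ ⊗ B₁))
∅⇝-tensorPairs A₀ B₀ A₁ B₁ ∅⇝AB₀ ∅⇝AB₁ = begin
  emptyG                          ≲⟨ ∅⇝-tensor ∅⇝AB₀ ∅⇝AB₁ ⟩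
  (A₀ ⊔ B₀) ⊗ (A₁ ⊔ B₁)           ≈⟨ ⊗-cong (⊔-comm A₀ B₀) ≅-refl ⟩
  (B₀ ⊔ A₀) ⊗ (A₁ ⊔ B₁)           ≲⟨ switch B₀ A₀ (A₁ ⊔ B₁) ⟩
  (B₀ ⊗ (A₁ ⊔ B₁)) ⊔ A₀           ≈⟨ ⊔-comm _ A₀ ⟩
  A₀ ⊔ (B₀ ⊗ (A₁ ⊔ B₁))           ≲⟨ ⇝-plug A₀ (λ _ → false) (begin
      B₀ ⊗ (A₁ ⊔ B₁)                ≈⟨ ≅-trans (⊗-comm B₀ _) (⊗-cong (⊔-comm A₁ B₁) ≅-refl) ⟩
      (B₁ ⊔ A₁) ⊗ B₀                ≲⟨ switch B₁ A₁ B₀ ⟩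
      (B₁ ⊗ B₀) ⊔ A₁                ∎) ⟩
  A₀ ⊔ ((B₁ ⊗ B₀) ⊔ A₁)           ≈⟨ ⊔-cong (≅-refl {A₀}) (⊔-comm _ A₁) ⟩
  A₀ ⊔ (A₁ ⊔ (B₁ ⊗ B₀))           ≈⟨ ⊔-assoc A₀ A₁ _ ⟨
  (A₀ ⊔ A₁) ⊔ (B₁ ⊗ B₀)           ≈⟨ ⊔-cong (≅-refl {A₀ ⊔ A₁}) (⊗-comm B₁ B₀) ⟩
  (A₀ ⊔ A₁) ⊔ (B₀ ⊗ B₁)           ∎
  where open ⇝-Reasoning

∅⇝-bigTensor : ∀ n (F : Fin n → Graph) → (∀ i → emptyG ⇝ F i) → emptyG ⇝ bigTensor n F
∅⇝-bigTensor zero    F ∅⇝F D T d = d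
∅⇝-bigTensor (suc n) F ∅⇝F = ∅⇝-tensor (∅⇝F zero) (∅⇝-bigTensor n (λ i → F (suc i)) (λ i → ∅⇝F (suc i)))

-- Modules

Fiber-suc-∉ : ∀ {n} (S : Fin (suc n) → Bool) {b} → S zero ≢ b → Fiber (S ∘′ suc) b ↔ Fiber S b
Fiber-suc-∉ S S0≢b = mk↔ₛ′ (λ (x , p) → suc x , p) pred (λ { (zero , p) → ⊥-elim (S0≢b p) ; (suc x , p) → refl })
                                                         (λ _ → refl)
  where
  pred : Fiber S _ → Fiber (S ∘′ suc) _
  pred (zero  , p) = ⊥-elim (S0≢b p)
  pred (suc x , p) = x , p

Fiber-suc-∈ : ∀ {n} (S : Fin (suc n) → Bool) {b} → S zero ≡ b → (⊤ ⊎ Fiber (S ∘′ suc) b) ↔ Fiber S b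
Fiber-suc-∈ S {b} S0≡b = mk↔ₛ′ cons uncons cons∘uncons (λ { (inj₁ tt) → refl ; (inj₂ _) → refl })
  where
  cons : ⊤ ⊎ Fiber (S ∘′ suc) b → Fiber S b
  cons (inj₁ _)       = zero , S0≡b
  cons (inj₂ (x , p)) = suc x , p
  uncons : Fiber S b → ⊤ ⊎ Fiber (S ∘′ suc) b
  uncons (zero  , _) = inj₁ tt
  uncons (suc x , p) = inj₂ (x , p)
  cons∘uncons : ∀ y → cons (uncons y) ≡ y
  cons∘uncons (zero  , p) = Fiber-≡ refl
  cons∘uncons (suc x , p) = refl

Fin-suc↔ : ∀ {k} → Fin (suc k) ↔ (⊤ ⊎ Fin k)
Fin-suc↔ = ↔-trans +↔⊎ (1↔⊤ ⊎-↔ ↔-refl)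

↔-Fin-nonempty : ∀ {k} {X : Set} → Fin k ↔ X → X → 0 < k
↔-Fin-nonempty {zero}  e x with from e x
... | ()
↔-Fin-nonempty {suc k} e x = s≤s z≤n

↔-Fin-two : ∀ {k} {X : Set} → Fin k ↔ X → (x x′ : X) → x ≢ x′ → 2 ≤ k
↔-Fin-two {zero} e x x′ x≢x′ with from e x
... | ()
↔-Fin-two {suc zero} e x x′ x≢x′ = ⊥-elim (x≢x′ (↔-injective (↔-sym e) (Fin1-unique (from e x) (from e x′))))
  where
  Fin1-unique : (i j : Fin 1) → i ≡ j
  Fin1-unique zero zero = refl
↔-Fin-two {suc (suc k)} e x x′ x≢x′ = s≤s (s≤s z≤n)

∑-nonempty : ∀ k s → 0 < k → (∀ i → 0 < s i) → 0 < ∑ k s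
∑-nonempty (suc k) s _ s-pos = ≤-trans (s-pos zero) (m≤m+n (s zero) _)

record Enumeration {n} (S : Fin n → Bool) : Set where
  field
    #false #true : ℕ
    #false+#true : #false + #true ≡ n
    enumFalse    : Fin #false ↔ Fiber S false
    enumTrue     : Fin #true ↔ Fiber S true

enumerate : ∀ {n} (S : Fin n → Bool) → Enumeration S
enumerate {zero} S = record
  { #false = 0 ; #true = 0 ; #false+#true = refl
  ; enumFalse = mk↔ₛ′ (λ ()) (λ ()) (λ ()) (λ ()) ; enumTrue = mk↔ₛ′ (λ ()) (λ ()) (λ ()) (λ ()) }
enumerate {suc n} S with enumerate (S ∘′ suc) | S zero in S0
... | e | true = record
  { #false = #false ; #true = suc #true
  ; #false+#true = trans (+-suc #false #true) (cong suc #false+#true)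
  ; enumFalse = ↔-trans enumFalse (Fiber-suc-∉ S (Bool.not-¬ S0))
  ; enumTrue = ↔-trans Fin-suc↔ (↔-trans (↔-refl ⊎-↔ enumTrue) (Fiber-suc-∈ S S0)) }
  where open Enumeration e
... | e | false = record
  { #false = suc #false ; #true = #true
  ; #false+#true = cong suc #false+#true
  ; enumFalse = ↔-trans Fin-suc↔ (↔-trans (↔-refl ⊎-↔ enumFalse) (Fiber-suc-∈ S S0))
  ; enumTrue = ↔-trans enumTrue (Fiber-suc-∉ S (Bool.not-¬ S0)) }
  where open Enumeration e

Trivial : ∀ {n} → (Fin n → Bool) → Set
Trivial S = (∀ x → S x ≡ false) ⊎ (∃[ x ] (∀ y → S y ≡ true → y ≡ x) × S x ≡ true) ⊎ (∀ x → S x ≡ true)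

IsModule? : (Q : Graph) → ∀ S → Dec (IsModule Q S)
IsModule? Q S = all? λ v → (S v Bool.≟ false) →-dec
  (all? (λ x → (S x Bool.≟ true) →-dec (adj Q v x Bool.≟ true))
   ⊎-dec all? (λ x → (S x Bool.≟ true) →-dec (adj Q v x Bool.≟ false)))

Trivial? : ∀ {n} (S : Fin n → Bool) → Dec (Trivial S)
Trivial? S = all? (λ x → S x Bool.≟ false) ⊎-dec
  (any? (λ x → all? (λ y → (S y Bool.≟ true) →-dec (y Fin.≟ x)) ×-dec (S x Bool.≟ true))
   ⊎-dec all? (λ x → S x Bool.≟ true))

IsModule-resp : (Q : Graph) → ∀ {S S′} → (∀ x → S x ≡ S′ x) → IsModule Q S → IsModule Q S′
IsModule-resp Q S≗S′ isMod v S′v with isMod v (trans (S≗S′ v) S′v)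
... | inj₁ all-adj = inj₁ (λ x S′x → all-adj x (trans (S≗S′ x) S′x))
... | inj₂ none-adj = inj₂ (λ x S′x → none-adj x (trans (S≗S′ x) S′x))

Trivial-resp : ∀ {n} {S S′ : Fin n → Bool} → (∀ x → S x ≡ S′ x) → Trivial S → Trivial S′
Trivial-resp S≗S′ (inj₁ empty) = inj₁ (λ x → trans (sym (S≗S′ x)) (empty x))
Trivial-resp S≗S′ (inj₂ (inj₁ (x , only-x , Sx))) =
  inj₂ (inj₁ (x , (λ y S′y → only-x y (trans (S≗S′ y) S′y)) , trans (sym (S≗S′ x)) Sx))
Trivial-resp S≗S′ (inj₂ (inj₂ full)) = inj₂ (inj₂ (λ x → trans (sym (S≗S′ x)) (full x)))

record NontrivialModule (Q : Graph) : Set where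
  field
    S        : Fin (size Q) → Bool
    isModule : IsModule Q S
    r y z    : Fin (size Q)
    r∈S      : S r ≡ true
    y∈S      : S y ≡ true
    r≢y      : r ≢ y
    z∉S      : S z ≡ false

nontrivialModule : (Q : Graph) → ∀ S → IsModule Q S → ¬ Trivial S → NontrivialModule Q
nontrivialModule Q S isMod ¬trivial = record
  { S = S ; isModule = isMod ; r = r ; y = y ; z = z ; r∈S = r∈S ; y∈S = y∈S ; r≢y = r≢y ; z∉S = z∉S }
  where
  n = size Q
  notEmpty = ¬∀⟶∃¬ n _ (λ x → S x Bool.≟ false) (λ empty → ¬trivial (inj₁ empty))
  notFull  = ¬∀⟶∃¬ n _ (λ x → S x Bool.≟ true) (λ full → ¬trivial (inj₂ (inj₂ full)))
  r = proj₁ notEmpty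
  r∈S = Bool.¬-not (proj₂ notEmpty)
  z = proj₁ notFull
  z∉S = Bool.¬-not (proj₂ notFull)
  notOnlyR = ¬∀⟶∃¬ n (λ y → S y ≡ true → y ≡ r) (λ y → (S y Bool.≟ true) →-dec (y Fin.≟ r))
                   (λ only-r → ¬trivial (inj₂ (inj₁ (r , only-r , r∈S))))
  y = proj₁ notOnlyR
  y∈S : S y ≡ true
  y∈S with S y Bool.≟ true
  ... | yes y∈S = y∈S
  ... | no y∉S = ⊥-elim (proj₂ notOnlyR (λ y∈S → ⊥-elim (y∉S y∈S)))
  r≢y : r ≢ y
  r≢y r≡y = proj₂ notOnlyR (λ _ → sym r≡y)

prime-or-nontrivialModule : ∀ Q → 2 ≤ size Q → IsPrime Q ⊎ NontrivialModule Q
prime-or-nontrivialModule Q 2≤Q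
  with anySubset? (λ s → IsModule? Q (lookup s) ×-dec ¬? (Trivial? (lookup s)))
... | yes (s , isMod , ¬trivial) = inj₂ (nontrivialModule Q (lookup s) isMod ¬trivial)
... | no ¬nontrivial = inj₁ (2≤Q , trivial)
  where
  trivial : ∀ S → IsModule Q S → Trivial S
  trivial S isMod with Trivial? S
  ... | yes t = t
  ... | no ¬t = ⊥-elim (¬nontrivial (tabulate S , IsModule-resp Q (λ x → sym (lookup∘tabulate S x)) isMod
                                     , λ t → ¬t (Trivial-resp (lookup∘tabulate S) t)))

pattern 0F = zero
pattern 1F = suc zero
pattern 2F = suc (suc zero)

allBut : ∀ {n} → Fin n → Fin n → Bool
allBut c x = not (does (x Fin.≟ c))

allButOne-isModule : (Q : Graph) (S : Fin (size Q) → Bool) (c x₀ : Fin (size Q)) → S x₀ ≡ true →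
  (∀ v → S v ≡ false → v ≡ c) → (∀ x → S x ≡ true → adj Q c x ≡ adj Q c x₀) → IsModule Q S
allButOne-isModule Q S c x₀ _ only-c alike v v∉S with only-c v v∉S
... | refl with adj Q c x₀ in e
...   | true  = inj₁ alike
...   | false = inj₂ alike

-- Two of the three edges agree (three Booleans), and their common vertex sees the other two alike.
threeVertices-nontrivialModule : (Q : Graph) → size Q ≡ 3 → NontrivialModule Q
threeVertices-nontrivialModule Q@record { size = 3 ; adj = a ; adj-sym = s } refl
  with a 2F 0F Bool.≟ a 2F 1F | a 0F 1F Bool.≟ a 0F 2F | a 1F 0F Bool.≟ a 1F 2F
... | yes e | _ | _ = record
  { S = allBut 2F
  ; isModule = allButOne-isModule Q _ 2F 0F refl (λ { 2F _ → refl ; 0F () ; 1F () })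
                                        (λ { 0F _ → refl ; 1F _ → sym e ; 2F () })
  ; r = 0F ; y = 1F ; z = 2F ; r∈S = refl ; y∈S = refl ; r≢y = λ () ; z∉S = refl }
... | no _ | yes e | _ = record
  { S = allBut 0F
  ; isModule = allButOne-isModule Q _ 0F 1F refl (λ { 0F _ → refl ; 1F () ; 2F () })
                                        (λ { 1F _ → refl ; 2F _ → sym e ; 0F () })
  ; r = 1F ; y = 2F ; z = 0F ; r∈S = refl ; y∈S = refl ; r≢y = λ () ; z∉S = refl }
... | no _ | no _ | yes e = record
  { S = allBut 1F
  ; isModule = allButOne-isModule Q _ 1F 0F refl (λ { 1F _ → refl ; 0F () ; 2F () })
                                        (λ { 0F _ → refl ; 2F _ → sym e ; 1F () })
  ; r = 0F ; y = 2F ; z = 1F ; r∈S = refl ; y∈S = refl ; r≢y = λ () ; z∉S = refl }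
... | no a20≢a21 | no a01≢a02 | no a10≢a12 =
  ⊥-elim (threeBools (a 0F 1F) (a 0F 2F) (a 1F 2F)
           (λ e → a20≢a21 (trans (s 2F 0F) (trans e (s 1F 2F)))) a01≢a02
           (λ e → a10≢a12 (trans (sym (s 0F 1F)) e)))
  where
  threeBools : ∀ (x y z : Bool) → y ≢ z → x ≢ y → x ≢ z → ⊥
  threeBools false false _     _   x≢y _   = x≢y refl
  threeBools true  true  _     _   x≢y _   = x≢y refl
  threeBools false true  false _   _   x≢z = x≢z refl
  threeBools false true  true  y≢z _   _   = y≢z refl
  threeBools true  false true  _   _   x≢z = x≢z refl
  threeBools true  false false y≢z _   _   = y≢z refl

-- The identity lemma

record Premises {n} (A B : Fin n → Graph) : Set where
  field
    A-nonempty : ∀ i → 0 < size (A i)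
    ∅⇝A⊔B      : ∀ i → emptyG ⇝ (A i ⊔ B i)
open Premises

Identity : (Q : Graph) → (A B : Fin (size Q) → Graph) → Set
Identity Q A B = emptyG ⇝ ((dualG Q ⟨ A ⟩) ⊔ (Q ⟨ B ⟩))

identity-empty : ∀ Q → size Q ≡ 0 → ∀ {A B} → Identity Q A B
identity-empty record { size = 0 } refl = ≅⇒⇝ (≃⇒≅ (≃-empty (λ ()) (λ ())))

identity-singleton : ∀ Q → size Q ≡ 1 → ∀ {A B} → Premises A B → Identity Q A B
identity-singleton Q@record { size = 1 } refl {A} {B} p = ⇝-trans (∅⇝A⊔B p 0F) (≅⇒⇝ (⊔-cong
  (≃⇒≅ (≃-sym (≃-trans (setGraph-sub (dualG Q) A) (subˢ-singleton (dualG Q) refl 0F _))))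
  (≃⇒≅ (≃-sym (≃-trans (setGraph-sub Q B) (subˢ-singleton Q refl 0F _))))))

∅⇝-pairs : ∀ b A₀ B₀ A₁ B₁ → emptyG ⇝ (A₀ ⊔ B₀) → emptyG ⇝ (A₁ ⊔ B₁) →
  emptyG ⇝ (glue A₀ A₁ (λ _ _ → not b) ⊔ glue B₀ B₁ (λ _ _ → b))
∅⇝-pairs true  A₀ B₀ A₁ B₁ ∅⇝AB₀ ∅⇝AB₁ = ∅⇝-tensorPairs A₀ B₀ A₁ B₁ ∅⇝AB₀ ∅⇝AB₁
∅⇝-pairs false A₀ B₀ A₁ B₁ ∅⇝AB₀ ∅⇝AB₁ =
  ⇝-trans (∅⇝-tensorPairs B₀ A₀ B₁ A₁ (⇝-trans ∅⇝AB₀ (≅⇒⇝ (⊔-comm A₀ B₀)))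
                                      (⇝-trans ∅⇝AB₁ (≅⇒⇝ (⊔-comm A₁ B₁))))
          (≅⇒⇝ (⊔-comm (B₀ ⊔ B₁) (A₀ ⊗ A₁)))

sub-pair : ∀ {l a s i} (H : Fin 2 → Graph) →
  let Q = record { size = 2 ; lab = l ; adj = a ; adj-sym = s ; adj-irrefl = i } in
  (Q ⟨ H ⟩) ≅ glue (H 0F) (H 1F) (λ _ _ → a 0F 1F)
sub-pair H = ≃⇒≅ (≃-trans (setGraph-sub _ H)
  (≃-trans (subˢ-pair (λ j → setGraph (H j))) (≃-sym (setGraph-glue (H 0F) (H 1F) _))))

identity-pair : ∀ Q → size Q ≡ 2 → ∀ {A B} → Premises A B → Identity Q A B
identity-pair Q@record { size = 2 ; adj = a } refl {A} {B} p =
  ⇝-trans (∅⇝-pairs (a 0F 1F) (A 0F) (B 0F) (A 1F) (B 1F) (∅⇝A⊔B p 0F) (∅⇝A⊔B p 1F))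
          (≅⇒⇝ (⊔-cong (≅-sym (sub-pair A)) (≅-sym (sub-pair B))))

identity-prime : ∀ Q → IsPrime Q → 4 ≤ size Q → ∀ {A B} → Premises A B → Identity Q A B
identity-prime Q prime 4≤Q {A} {B} p =
  ⇝-trans (∅⇝-bigTensor (size Q) (λ i → A i ⊔ B i) (∅⇝A⊔B p)) (rule⇒⇝ (p↓ Q prime 4≤Q A B (A-nonempty p)))

module ViaNontrivialModule (Q : Graph) (m : NontrivialModule Q)
  (IH : ∀ Q′ → size Q′ < size Q → ∀ {A B} → Premises A B → Identity Q′ A B)
  {A B : Fin (size Q) → Graph} (p : Premises A B) where

  open NontrivialModule m
  open Enumeration (enumerate S)

  module-edge : ∀ v x → S v ≡ false → S x ≡ true → adj Q v x ≡ adj Q v r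
  module-edge v x v∉S x∈S with isModule v v∉S
  ... | inj₁ all-adj  = trans (all-adj x x∈S) (sym (all-adj r r∈S))
  ... | inj₂ none-adj = trans (none-adj x x∈S) (sym (none-adj r r∈S))

  module C = Collapse (setGraph Q) S r r∈S module-edge
  module C̄ = Collapse (dualˢ (setGraph Q)) S r r∈S (module-edge-dual (setGraph Q) S r r∈S module-edge)

  quotientEnum : Fin (suc #false) ↔ C.Quotient
  quotientEnum = ↔-trans Fin-suc↔ (↔-refl ⊎-↔ enumFalse)

  quotientVertex : Fin (suc #false) → Fin (size Q)
  quotientVertex i = C.embed (to quotientEnum i)

  insideVertex : Fin #true → Fin (size Q)
  insideVertex i = proj₁ (to enumTrue i)

  quotientVertex-injective : ∀ {i j} → quotientVertex i ≡ quotientVertex j → i ≡ j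
  quotientVertex-injective e = ↔-injective quotientEnum (C.embed-injective e)

  insideVertex-injective : ∀ {i j} → insideVertex i ≡ insideVertex j → i ≡ j
  insideVertex-injective e = ↔-injective enumTrue (Fiber-≡ e)

  Inside Quotient : Graph
  Inside   = pullback Q #true insideVertex
  Quotient = pullback Q (suc #false) quotientVertex

  A-inside B-inside : Fin #true → Graph
  A-inside i = A (insideVertex i)
  B-inside i = B (insideVertex i)

  collapsedA collapsedB : C.Quotient → Graph
  collapsedA (inj₁ _)       = dualG Inside ⟨ A-inside ⟩
  collapsedA (inj₂ (i , _)) = A i
  collapsedB (inj₁ _)       = Inside ⟨ B-inside ⟩
  collapsedB (inj₂ (i , _)) = B i

  A-quotient B-quotient : Fin (suc #false) → Graph
  A-quotient i = collapsedA (to quotientEnum i)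
  B-quotient i = collapsedB (to quotientEnum i)

  2≤#true : 2 ≤ #true
  2≤#true = ↔-Fin-two enumTrue (r , r∈S) (y , y∈S) (λ e → r≢y (cong proj₁ e))

  Inside<Q : #true < size Q
  Inside<Q = subst (#true <_) #false+#true (m<n+m #true (↔-Fin-nonempty enumFalse (z , z∉S)))

  Quotient<Q : suc #false < size Q
  Quotient<Q = subst (suc #false <_) #false+#true
    (subst (_≤ #false + #true) (+-comm #false 2) (+-monoʳ-≤ #false 2≤#true))

  inside-identity : Identity Inside A-inside B-inside
  inside-identity = IH Inside Inside<Q record
    { A-nonempty = λ i → A-nonempty p (insideVertex i) ; ∅⇝A⊔B = λ i → ∅⇝A⊔B p (insideVertex i) }

  quotient-premises : Premises A-quotient B-quotient
  quotient-premises = record { A-nonempty = nonempty ; ∅⇝A⊔B = derivable }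
    where
    nonempty : ∀ i → 0 < size (A-quotient i)
    nonempty i with to quotientEnum i
    ... | inj₁ _       = ∑-nonempty #true _ (≤-trans (s≤s z≤n) 2≤#true) (λ j → A-nonempty p (insideVertex j))
    ... | inj₂ (v , _) = A-nonempty p v
    derivable : ∀ i → emptyG ⇝ (A-quotient i ⊔ B-quotient i)
    derivable i with to quotientEnum i
    ... | inj₁ _       = inside-identity
    ... | inj₂ (v , _) = ∅⇝A⊔B p v

  quotient≃ : setGraph Quotient ≃ C.quotient
  quotient≃ =
    pullbackˢ-reindex {G = setGraph Q} {W-dec = Fin._≟_} {W′-dec = C.Quotient-dec} C.embed quotientEnum

  inside≃ : setGraph Inside ≃ C.inside
  inside≃ = pullbackˢ-reindex {G = setGraph Q} {W-dec = Fin._≟_} {W′-dec = Fiber-dec Fin._≟_} proj₁ enumTrue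

  dualQuotient≃ : setGraph (dualG Quotient) ≃ C̄.quotient
  dualQuotient≃ = ≃-trans (setGraph-dual Quotient)
    (≃-trans (dualˢ-pullbackˢ {G = setGraph Q} {W-dec = Fin._≟_} quotientVertex quotientVertex-injective)
             (pullbackˢ-reindex {G = dualˢ (setGraph Q)} {W-dec = Fin._≟_} {W′-dec = C̄.Quotient-dec}
                                C̄.embed quotientEnum))

  dualInside≃ : setGraph (dualG Inside) ≃ C̄.inside
  dualInside≃ = ≃-trans (setGraph-dual Inside)
    (≃-trans (dualˢ-pullbackˢ {G = setGraph Q} {W-dec = Fin._≟_} insideVertex insideVertex-injective)
             (pullbackˢ-reindex {G = dualˢ (setGraph Q)} {W-dec = Fin._≟_} {W′-dec = Fiber-dec Fin._≟_}
                                proj₁ enumTrue))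

  quotient-B≃ : setGraph (Quotient ⟨ B-quotient ⟩) ≃ setGraph (Q ⟨ B ⟩)
  quotient-B≃ = begin
    setGraph (Quotient ⟨ B-quotient ⟩)                      ≈⟨ setGraph-sub Quotient B-quotient ⟩
    setGraph Quotient ⟨ (λ i → setGraph (B-quotient i)) ⟩ˢ  ≈⟨ subˢ-reindex quotient≃ _ ⟩
    C.quotient ⟨ (λ w → setGraph (collapsedB w)) ⟩ˢ         ≈⟨ subˢ-congʳ {C.quotient} inner ⟩
    C.quotient ⟨ C.collapsed (λ i → setGraph (B i)) ⟩ˢ      ≈⟨ C.collapse (λ i → setGraph (B i)) ⟨
    setGraph Q ⟨ (λ i → setGraph (B i)) ⟩ˢ                  ≈⟨ setGraph-sub Q B ⟨
    setGraph (Q ⟨ B ⟩)                                      ∎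
    where
    open ≃-Reasoning
    inner : ∀ w → setGraph (collapsedB w) ≃ C.collapsed (λ i → setGraph (B i)) w
    inner (inj₁ _) = ≃-trans (setGraph-sub Inside B-inside) (subˢ-reindex inside≃ (λ (v , _) → setGraph (B v)))
    inner (inj₂ _) = ≃-refl

  quotient-A≃ : setGraph (dualG Quotient ⟨ A-quotient ⟩) ≃ setGraph (dualG Q ⟨ A ⟩)
  quotient-A≃ = begin
    setGraph (dualG Quotient ⟨ A-quotient ⟩)                       ≈⟨ setGraph-sub (dualG Quotient) A-quotient ⟩
    setGraph (dualG Quotient) ⟨ (λ i → setGraph (A-quotient i)) ⟩ˢ ≈⟨ subˢ-reindex dualQuotient≃ _ ⟩
    C̄.quotient ⟨ (λ w → setGraph (collapsedA w)) ⟩ˢ               ≈⟨ subˢ-congʳ {C̄.quotient} inner ⟩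
    C̄.quotient ⟨ C̄.collapsed (λ i → setGraph (A i)) ⟩ˢ            ≈⟨ C̄.collapse (λ i → setGraph (A i)) ⟨
    dualˢ (setGraph Q) ⟨ (λ i → setGraph (A i)) ⟩ˢ                 ≈⟨ subˢ-reindex (≃-sym (setGraph-dual Q)) _ ⟩
    setGraph (dualG Q) ⟨ (λ i → setGraph (A i)) ⟩ˢ                 ≈⟨ setGraph-sub (dualG Q) A ⟨
    setGraph (dualG Q ⟨ A ⟩)                                       ∎
    where
    open ≃-Reasoning
    inner : ∀ w → setGraph (collapsedA w) ≃ C̄.collapsed (λ i → setGraph (A i)) w
    inner (inj₁ _) = ≃-trans (setGraph-sub (dualG Inside) A-inside)
                             (subˢ-reindex dualInside≃ (λ (v , _) → setGraph (A v)))
    inner (inj₂ _) = ≃-refl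

  identity : Identity Q A B
  identity = ⇝-trans (IH Quotient Quotient<Q quotient-premises)
                     (≅⇒⇝ (⊔-cong (≃⇒≅ quotient-A≃) (≃⇒≅ quotient-B≃)))

identity : ∀ Q {A B : Fin (size Q) → Graph} → Premises A B → Identity Q A B
identity = All.wfRec (On.wellFounded size <-wellFounded) _ IdentityFor step
  where
  IdentityFor : Graph → Set
  IdentityFor Q = ∀ {A B} → Premises A B → Identity Q A B
  step : ∀ Q → WfRec (_<_ on size) IdentityFor Q → IdentityFor Q
  step Q IH = bySize (size Q) refl
    where
    IH′ : ∀ Q′ → size Q′ < size Q → IdentityFor Q′
    IH′ _ Q′<Q = IH Q′<Q
    bySize : ∀ n → size Q ≡ n → IdentityFor Q
    bySize 0 Q≡0 _ = identity-empty Q Q≡0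
    bySize 1 Q≡1 = identity-singleton Q Q≡1
    bySize 2 Q≡2 = identity-pair Q Q≡2
    bySize 3 Q≡3 = ViaNontrivialModule.identity Q (threeVertices-nontrivialModule Q Q≡3) IH′
    bySize (suc (suc (suc (suc _)))) Q≡n p
      with prime-or-nontrivialModule Q (subst (2 ≤_) (sym Q≡n) (s≤s (s≤s z≤n)))
    ... | inj₁ prime = identity-prime Q prime (subst (4 ≤_) (sym Q≡n) (s≤s (s≤s (s≤s (s≤s z≤n))))) p
    ... | inj₂ m     = ViaNontrivialModule.identity Q m IH′ p

-- Plugging a linear implication into a context

atom-premise : ∀ a → emptyG ⇝ (atomG (dual a) ⊔ atomG a)
atom-premise a = rule⇒⇝ (ai↓ a)

∅⇝-⊸-refl : ∀ C → emptyG ⇝ (C ⊸ C)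
∅⇝-⊸-refl C = ⇝-trans (identity C premises) (≅⇒⇝ (⊔-cong (≃⇒≅ dual≃) (≃⇒≅ plain≃)))
  where
  premises : Premises (λ c → atomG (dual (lab C c))) (λ c → atomG (lab C c))
  premises = record { A-nonempty = λ _ → s≤s z≤n ; ∅⇝A⊔B = λ c → atom-premise (lab C c) }
  dual≃ : setGraph (dualG C ⟨ (λ c → atomG (dual (lab C c))) ⟩) ≃ setGraph (dualG C)
  dual≃ = ≃-trans (setGraph-sub (dualG C) _) (≃-trans (subˢ-reindex (setGraph-dual C) _)
            (≃-trans (subˢ-atoms (dualˢ (setGraph C))) (≃-sym (setGraph-dual C))))
  plain≃ : setGraph (C ⟨ (λ c → atomG (lab C c)) ⟩) ≃ setGraph C
  plain≃ = ≃-trans (setGraph-sub C _) (subˢ-atoms (setGraph C))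

∅⇝-plug⊸-empty : ∀ G H C R → ¬ Fin (size G) → emptyG ⇝ (G ⊸ H) →
  emptyG ⇝ ((C [ G ]⟨ R ⟩) ⊸ (C [ H ]⟨ R ⟩))
∅⇝-plug⊸-empty G H C R ¬G ∅⇝G⊸H = begin
  emptyG                                   ≲⟨ ∅⇝-⊸-refl C ⟩
  dualG C ⊔ C                              ≈⟨ glue-emptyʳ (dualG C ⊔ C) {emptyG} _ (λ ()) ⟨
  (dualG C ⊔ C) [ emptyG ]⟨ T ⟩            ≲⟨ ⇝-plug (dualG C ⊔ C) T ∅⇝H ⟩
  (dualG C ⊔ C) [ H ]⟨ T ⟩                 ≈⟨ plug-plug (dualG C) C H (λ _ → false) R ⟨
  dualG C ⊔ (C [ H ]⟨ R ⟩)                 ≈⟨ ⊔-cong (dualG-cong (≅-sym (glue-emptyʳ C _ ¬G))) ≅-refl ⟩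
  dualG (C [ G ]⟨ R ⟩) ⊔ (C [ H ]⟨ R ⟩)    ∎
  where
  open ⇝-Reasoning
  T = composeContexts (dualG C) C (λ _ → false) R
  ∅⇝H : emptyG ⇝ H
  ∅⇝H = ⇝-trans ∅⇝G⊸H (≅⇒⇝ (glue-emptyˡ H _ ¬G))

-- Its label is irrelevant.
hole : Graph
hole = atomG (true , 0)

fillContext : (C : Graph) → (Atom → Atom) → Graph → Fin (size C + 1) → Graph
fillContext C f X x = Data.Sum.[ (λ c → atomG (f (lab C c))) , (λ _ → X) ] (splitAt (size C) x)

∅⇝-plug⊸-nonempty : ∀ G H C R → 0 < size G → emptyG ⇝ (G ⊸ H) →
  emptyG ⇝ ((C [ G ]⟨ R ⟩) ⊸ (C [ H ]⟨ R ⟩))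
∅⇝-plug⊸-nonempty G H C R G≢∅ ∅⇝G⊸H =
  ⇝-trans (identity Q premises) (≅⇒⇝ (⊔-cong (≃⇒≅ dual≃) (≃⇒≅ plain≃)))
  where
  Q = C [ hole ]⟨ R ⟩
  A B : Fin (size Q) → Graph
  A = fillContext C dual (dualG G)
  B = fillContext C (λ a → a) H

  premises : Premises A B
  premises = record { A-nonempty = nonempty ; ∅⇝A⊔B = derivable }
    where
    nonempty : ∀ x → 0 < size (A x)
    nonempty x with splitAt (size C) x
    ... | inj₁ _ = s≤s z≤n
    ... | inj₂ _ = G≢∅
    derivable : ∀ x → emptyG ⇝ (A x ⊔ B x)
    derivable x with splitAt (size C) x
    ... | inj₁ c = atom-premise (lab C c)
    ... | inj₂ _ = ∅⇝G⊸H

  plain≃ : setGraph (Q ⟨ B ⟩) ≃ setGraph (C [ H ]⟨ R ⟩)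
  plain≃ = begin
    setGraph (Q ⟨ B ⟩)
      ≈⟨ setGraph-sub Q B ⟩
    setGraph Q ⟨ (λ x → setGraph (B x)) ⟩ˢ
      ≈⟨ subˢ-reindex (setGraph-glue C hole _) _ ⟩
    glueˢ (setGraph C) (setGraph hole) (λ c _ → R c) ⟨ _ ⟩ˢ
      ≈⟨ glueˢ-sub-atoms (setGraph C) (setGraph hole) R (λ _ → H) ⟩
    glueˢ (setGraph C) (setGraph hole ⟨ (λ _ → setGraph H) ⟩ˢ) _
      ≈⟨ glueˢ-cong ≃-refl (subˢ-singleton hole refl zero _) (λ _ _ → refl) ⟩
    glueˢ (setGraph C) (setGraph H) (λ c _ → R c)
      ≈⟨ setGraph-glue C H _ ⟨
    setGraph (C [ H ]⟨ R ⟩)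
      ∎
    where open ≃-Reasoning

  dual≃ : setGraph (dualG Q ⟨ A ⟩) ≃ setGraph (dualG (C [ G ]⟨ R ⟩))
  dual≃ = begin
    setGraph (dualG Q ⟨ A ⟩)
      ≈⟨ setGraph-sub (dualG Q) A ⟩
    setGraph (dualG Q) ⟨ (λ x → setGraph (A x)) ⟩ˢ
      ≈⟨ subˢ-reindex dualQ≃ _ ⟩
    glueˢ (dualˢ (setGraph C)) (dualˢ (setGraph hole)) (λ c _ → not (R c)) ⟨ _ ⟩ˢ
      ≈⟨ glueˢ-sub-atoms (dualˢ (setGraph C)) (dualˢ (setGraph hole)) (λ c → not (R c)) (λ _ → dualG G) ⟩
    glueˢ (dualˢ (setGraph C)) (dualˢ (setGraph hole) ⟨ (λ _ → setGraph (dualG G)) ⟩ˢ) _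
      ≈⟨ glueˢ-cong ≃-refl hole≃ (λ _ _ → refl) ⟩
    glueˢ (dualˢ (setGraph C)) (dualˢ (setGraph G)) (λ c _ → not (R c))
      ≈⟨ dualˢ-glueˢ _ _ _ ⟨
    dualˢ (glueˢ (setGraph C) (setGraph G) (λ c _ → R c))
      ≈⟨ dualˢ-cong (setGraph-glue C G _) ⟨
    dualˢ (setGraph (C [ G ]⟨ R ⟩))
      ≈⟨ setGraph-dual _ ⟨
    setGraph (dualG (C [ G ]⟨ R ⟩))
      ∎
    where
    open ≃-Reasoning
    dualQ≃ : setGraph (dualG Q) ≃ glueˢ (dualˢ (setGraph C)) (dualˢ (setGraph hole)) (λ c _ → not (R c))
    dualQ≃ = ≃-trans (setGraph-dual Q) (≃-trans (dualˢ-cong (setGraph-glue C hole _)) (dualˢ-glueˢ _ _ _))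
    hole≃ : dualˢ (setGraph hole) ⟨ (λ _ → setGraph (dualG G)) ⟩ˢ ≃ dualˢ (setGraph G)
    hole≃ = ≃-trans (≃-sym (subˢ-reindex (setGraph-dual hole) _))
                    (≃-trans (subˢ-singleton (dualG hole) refl zero _) (setGraph-dual G))

∅⇝-plug⊸ : ∀ G H C R → emptyG ⇝ (G ⊸ H) → emptyG ⇝ ((C [ G ]⟨ R ⟩) ⊸ (C [ H ]⟨ R ⟩))
∅⇝-plug⊸ G H C R with Fin-empty-or-nonempty (size G)
... | inj₁ G≡∅ = ∅⇝-plug⊸-empty G H C R G≡∅
... | inj₂ G≢∅ = ∅⇝-plug⊸-nonempty G H C R G≢∅

corollary5p8 : (G H C : Graph) (R : Fin (size C) → Bool) →
    ⊢GS (G ⊸ H) → ⊢GS ((C [ G ]⟨ R ⟩) ⊸ (C [ H ]⟨ R ⟩))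
corollary5p8 G H C R ⊢G⊸H = ∅⇝⇒⊢ (∅⇝-plug⊸ G H C R (⊢⇒∅⇝ ⊢G⊸H))
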